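{- Let $\pi$ be an $n$-dimensional subspace of $\mathrm{PG}(2n+1,q^{2})$. Denote by $v_{\pi}$ the incidence vector of $\pi\cap\mathcal{H}(2n+1,q^{2})$ and by $v_{\pi^{\sigma}}$ the incidence vector of $\pi^{\sigma}\cap\mathcal{H}(2n+1,q^{2})$. Then for every $\alpha\in\mathbb{F}_{p}$, $\alpha(v_{\pi}-v_{\pi^{\sigma}})$ is a code word of $C_{n}(\mathcal{H}(2n+1,q^{2}))^{\perp}$.
   Context: $q$ is a power of the prime $p$. $\mathcal{H}(2n+1,q^2)$ is the non-singular Hermitian variety $X_0^{q+1}+\dots+X_{2n+1}^{q+1}=0$ in $\mathrm{PG}(2n+1,q^2)$ with associated Hermitian polarity $\sigma$; generators are the $n$-dimensional subspaces contained in it. $C_{n}(\mathcal{H}(2n+1,q^{2}))^{\perp}$ is the set of vectors $c\in\mathbb{F}_p^{\mathcal{P}}$ ($\mathcal{P}$ the point set of the variety) with $\sum_{P\in\mu}c_P=0$ for every generator $\mu$. Incidence vectors are taken in $\mathbb{F}_p^{\mathcal{P}}$. -}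

module Defs where

open import Level using (0ℓ)
open import Data.Nat as ℕ using (ℕ; zero; suc)
open import Data.Fin using (Fin; zero; suc)
open import Data.Integer as ℤ using (ℤ; +_)
open import Data.Integer.Divisibility using (_∣_)
open import Data.List using (List; length; map; foldr)
open import Data.List.Relation.Unary.All using (All)
open import Data.List.Relation.Unary.Any using (Any)
open import Data.List.Relation.Unary.AllPairs using (AllPairs)
open import Data.List.Relation.Unary.Unique.Propositional using (Unique)
open import Data.List.Membership.Propositional using (_∈_)
open import Data.Product using (Σ; _×_)
open import Relation.Nullary using (¬_)
open import Relation.Binary.PropositionalEquality using (_≡_)
open import Algebra.Structures using (IsCommutativeRing)

record Field : Set₁ where
  field
    K   : Set
    _+_ : K → K → K
    _*_ : K → K → K
    -_  : K → K
    0#  : K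
    1#  : K
    isCommutativeRing : IsCommutativeRing _≡_ _+_ _*_ -_ 0# 1#
    0≢1 : ¬ (0# ≡ 1#)
    inverse : ∀ x → ¬ (x ≡ 0#) → Σ K (λ y → (x * y) ≡ 1#)

record HasOrder (F : Field) (N : ℕ) : Set where
  open Field F
  field
    elems    : List K
    unique   : Unique elems
    complete : ∀ x → x ∈ elems
    size     : length elems ≡ N

-- Projective geometry PG(m-1, F) with the Hermitian form
-- h(u,w) = Σ_j u_j w_j^q, where q is the square root of the field order.
module Geometry (F : Field) (q : ℕ) where
  open Field F

  Vect : ℕ → Set
  Vect m = Fin m → K

  pow : K → ℕ → K
  pow x zero    = 1#
  pow x (suc k) = x * pow x k

  conj : K → K
  conj x = pow x q

  sumFin : ∀ {m} → (Fin m → K) → K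
  sumFin {zero}  f = 0#
  sumFin {suc m} f = f zero + sumFin (λ i → f (suc i))

  -- Hermitian sesquilinear form associated with X_0^{q+1}+...+X_{m-1}^{q+1}
  herm : ∀ {m} → Vect m → Vect m → K
  herm u w = sumFin (λ j → u j * conj (w j))

  NonZero : ∀ {m} → Vect m → Set
  NonZero v = ¬ (∀ j → v j ≡ 0#)

  _~_ : ∀ {m} → Vect m → Vect m → Set
  v ~ w = Σ K (λ c → ¬ (c ≡ 0#) × (∀ j → v j ≡ c * w j))

  comb : ∀ {k m} → (Fin k → K) → (Fin k → Vect m) → Vect m
  comb c b j = sumFin (λ i → c i * b i j)

  LinIndep : ∀ {k m} → (Fin k → Vect m) → Set
  LinIndep b = ∀ c → (∀ j → comb c b j ≡ 0#) → ∀ i → c i ≡ 0#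

  InSpan : ∀ {k m} → (Fin k → Vect m) → Vect m → Set
  InSpan b v = Σ (Fin _ → _) (λ c → ∀ j → v j ≡ comb c b j)

  -- a projective subspace of dimension d of PG(m-1, F), given by a basis
  -- of the underlying (d+1)-dimensional vector subspace
  record Subspace (d m : ℕ) : Set where
    field
      basis : Fin (suc d) → Vect m
      indep : LinIndep basis

  _∋ₚ_ : ∀ {d m} → Subspace d m → Vect m → Set
  π ∋ₚ v = InSpan (Subspace.basis π) v

  -- the Hermitian polarity σ : π ↦ π^σ (as a set of vectors)
  polar : ∀ {d m} → Subspace d m → Vect m → Set
  polar π w = ∀ u → π ∋ₚ u → herm u w ≡ 0#

  OnH : ∀ {m} → Vect m → Set
  OnH v = herm v v ≡ 0#

  record Generator (n : ℕ) : Set where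
    field
      space     : Subspace n (suc (suc (n ℕ.+ n)))
      contained : ∀ v → space ∋ₚ v → OnH v

  -- f : points → F_p (values in ℤ, read modulo p) is the incidence vector of S
  IsIncidenceVector : ∀ {m} → (Vect m → Set) → (Vect m → ℤ) → Set
  IsIncidenceVector S f =
    ∀ v → NonZero v → (S v → f v ≡ + 1) × (¬ S v → f v ≡ + 0)

  -- L is a list containing exactly one representative of each projective
  -- point of the (projectively closed) vector set S
  EnumeratesPoints : ∀ {m} → (Vect m → Set) → List (Vect m) → Set
  EnumeratesPoints S L =
    All NonZero L × All S L × AllPairs (λ v w → ¬ (v ~ w)) L
    × (∀ v → NonZero v → S v → Any (λ w → v ~ w) L)

  -- c ∈ F_p^P (well defined on projective points of H, modulo p) lies in
  -- C_n(H(2n+1,q^2))^⊥ : the sum over the points of every generator is 0 mod p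
  InDualCode : (p n : ℕ) → (Vect (suc (suc (n ℕ.+ n))) → ℤ) → Set
  InDualCode p n c =
    (∀ v w → NonZero v → OnH v → v ~ w → (+ p) ∣ (c v ℤ.- c w))
    × (∀ (μ : Generator n) (L : List (Vect (suc (suc (n ℕ.+ n)))))
         → EnumeratesPoints (Generator.space μ ∋ₚ_) L
         → (+ p) ∣ foldr ℤ._+_ (+ 0) (map c L))

-- A generator μ is totally isotropic: its vectors are isotropic and x ↦ x^q is not the identity of
-- F_{q²}. Hence μ meets π if and only if it meets π^σ. A nonzero u ∈ μ ∩ π is orthogonal to all of μ,
-- so the n + 1 conditions h(π, w) = 0 on the (n+1)-dimensional μ are dependent and have a nonzero
-- solution; conversely a nonzero w ∈ μ ∩ π^σ is orthogonal to μ + π, which is therefore a proper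
-- subspace, and then μ and π meet. Finally a nonzero subspace of F_{q²}^{2n+2} has a number of vectors
-- divisible by q² and (q² - 1) vectors on each of its points, so its number of points is 1 mod p. On every
-- generator v_π and v_{π^σ} therefore sum to the same value mod p.

module Submission where

open import Defs
open import Level using (0ℓ)
open import Algebra.Bundles using (CommutativeRing)
import Algebra.Properties.CommutativeSemigroup as CommutativeSemigroupProperties
import Algebra.Properties.Ring as RingProperties
import Algebra.Properties.Semiring.Binomial as BinomialTheorem
import Algebra.Properties.Semiring.Exp as SemiringExponentiation
import Algebra.Properties.Semiring.Mult as SemiringMultiplication
import Algebra.Properties.Semiring.Sum as SemiringSum
open import Data.Nat as ℕ using (ℕ; zero; suc; _≤_; _<_; z≤n; s≤s; _^_)
import Data.Nat.Properties as ℕ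
open import Data.Nat.Combinatorics using (_C_; nC1≡n; nCn≡1; nCk+nC[k+1]≡[n+1]C[k+1])
open import Data.Nat.Divisibility using (_∣_; divides; m∣m*n; n∣m*n; ∣-trans; ∣⇒≤)
open import Data.Nat.ListAction using (sum)
open import Data.Nat.ListAction.Properties using (sum-↭; sum-++)
open import Data.Nat.Primality using (Prime; euclidsLemma; prime⇒nonTrivial; prime⇒nonZero)
open import Data.Integer as ℤ using (ℤ)
import Data.Integer.Properties as ℤ
import Data.Integer.Divisibility as Unsigned
import Data.Integer.Divisibility.Signed as Signed
open import Data.Integer.Tactic.RingSolver renaming (solve-∀ to ℤ-solve-∀)
open import Data.Fin as Fin using (Fin; zero; suc; punchIn; punchOut; _↑ˡ_; _↑ʳ_)
import Data.Fin.Properties as Fin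
open import Data.Vec as Vec using (Vec; []; _∷_)
import Data.Vec.Properties as Vec
import Data.Vec.Functional as V
import Data.Vec.Functional.Properties as V
open import Data.List as List using (List; []; _∷_; map; length; _++_; cartesianProductWith)
import Data.List.Properties as List
open import Data.List.Relation.Unary.All as All using (All; []; _∷_)
import Data.List.Relation.Unary.All.Properties as All
open import Data.List.Relation.Unary.Any as Any using (Any; here; there)
import Data.List.Relation.Unary.Any.Properties as Any
open import Data.List.Relation.Unary.AllPairs using (AllPairs; []; _∷_)
import Data.List.Relation.Unary.AllPairs.Properties as AllPairs
open import Data.List.Relation.Unary.Unique.Propositional using (Unique)
import Data.List.Relation.Unary.Unique.Propositional.Properties as Unique
open import Data.List.Membership.Propositional using (_∈_; find)
open import Data.List.Membership.Propositional.Properties using (∈-map⁺; ∈-cartesianProductWith⁺)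
open import Data.List.Membership.Propositional.Properties.WithK using (unique∧set⇒bag)
open import Data.List.Relation.Binary.BagAndSetEquality using (∼bag⇒↭)
open import Data.List.Relation.Binary.Permutation.Propositional using (_↭_; ↭⇒↭ₛ)
import Data.List.Relation.Binary.Permutation.Propositional.Properties as ↭
open import Data.List.Relation.Binary.Permutation.Setoid.Properties using (foldr-commMonoid)
open import Data.Product using (∃; ∃-syntax; _×_; _,_; proj₁; proj₂)
open import Data.Sum using (inj₁; inj₂)
open import Function using (_∘_; case_of_)
open import Function.Bundles using (mk⇔)
open import Relation.Nullary using (¬_; Dec; yes; no; contradiction)
import Relation.Nullary.Decidable as Dec
open import Relation.Binary.Definitions using (DecidableEquality; _Respects_)
open import Relation.Binary.PropositionalEquality
  using (_≡_; _≢_; _≗_; refl; sym; trans; cong; cong₂; subst; setoid; module ≡-Reasoning)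

punchIn-cases : ∀ {k} (P : Fin (suc k) → Set) i₀ → P i₀ → (∀ i → P (punchIn i₀ i)) → ∀ i → P i
punchIn-cases P i₀ Pi₀ P-punchIn i with i Fin.≟ i₀
... | yes refl = Pi₀
... | no  i≢i₀ = subst P (Fin.punchIn-punchOut (i≢i₀ ∘ sym)) (P-punchIn (punchOut (i≢i₀ ∘ sym)))

↑-cases : ∀ {a b} (P : Fin (a ℕ.+ b) → Set) → (∀ i → P (i ↑ˡ b)) → (∀ i → P (a ↑ʳ i)) → ∀ t → P t
↑-cases {zero}  P _   P-↑ʳ t       = P-↑ʳ t
↑-cases {suc a} P P-↑ˡ _    zero    = P-↑ˡ zero
↑-cases {suc a} P P-↑ˡ P-↑ʳ (suc t) = ↑-cases (P ∘ suc) (P-↑ˡ ∘ suc) P-↑ʳ t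

module FieldProperties (F : Field) where

  open Field F public using (K; 0#; 1#; 0≢1; inverse; isCommutativeRing)

  infixl 6 _+_ _-_
  infixl 7 _*_
  infix  8 -_

  _+_ : K → K → K
  _+_ = Field._+_ F

  _*_ : K → K → K
  _*_ = Field._*_ F

  -_ : K → K
  -_ = Field.-_ F

  _-_ : K → K → K
  x - y = x + - y

  commRing : CommutativeRing 0ℓ 0ℓ
  commRing = record { isCommutativeRing = isCommutativeRing }

  open CommutativeRing commRing public
    using ( +-isCommutativeMonoid; +-assoc; +-comm; +-identityˡ; +-identityʳ; -‿inverseˡ; -‿inverseʳ
          ; *-assoc; *-comm; *-identityˡ; *-identityʳ; distribˡ; distribʳ; zeroˡ; zeroʳ )
  open RingProperties (CommutativeRing.ring commRing) public
    using ( -1*x≈-x; -‿distribˡ-*; -‿distribʳ-*; +-inverseʳ-unique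
          ; +-inverseˡ-unique; x∙y⁻¹≈ε⇒x≈y; x≈y⇒x∙y⁻¹≈ε; [y-z]x≈yx-zx; +-cancelˡ; +-cancelʳ )

  open SemiringMultiplication (CommutativeRing.semiring commRing) using (×1-homo-*) renaming (_×_ to _·_)

  fromℕ : ℕ → K
  fromℕ n = n · 1#

  fromℕ-* : ∀ m n → fromℕ (m ℕ.* n) ≡ fromℕ m * fromℕ n
  fromℕ-* = ×1-homo-*

  open CommutativeSemigroupProperties (CommutativeRing.+-commutativeSemigroup commRing) public
    using () renaming (interchange to +-interchange; x∙yz≈y∙xz to +-exchange; xy∙z≈xz∙y to +-swapʳ)
  open CommutativeSemigroupProperties (CommutativeRing.*-commutativeSemigroup commRing) public
    using () renaming (interchange to *-interchange; x∙yz≈y∙xz to *-exchange)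

  1≢0 : 1# ≢ 0#
  1≢0 = 0≢1 ∘ sym

  inv : (x : K) → x ≢ 0# → K
  inv x x≢0 = proj₁ (inverse x x≢0)

  x*inv≡1 : ∀ x (x≢0 : x ≢ 0#) → x * inv x x≢0 ≡ 1#
  x*inv≡1 x x≢0 = proj₂ (inverse x x≢0)

  inv*x≡1 : ∀ x (x≢0 : x ≢ 0#) → inv x x≢0 * x ≡ 1#
  inv*x≡1 x x≢0 = trans (*-comm _ x) (x*inv≡1 x x≢0)

  *-cancelˡ-≢0 : ∀ {a x y} → a ≢ 0# → a * x ≡ a * y → x ≡ y
  *-cancelˡ-≢0 {a} {x} {y} a≢0 ax≡ay = begin
    x                    ≡⟨ sym (*-identityˡ x) ⟩
    1# * x               ≡⟨ cong (_* x) (sym (inv*x≡1 a a≢0)) ⟩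
    (inv a a≢0 * a) * x  ≡⟨ *-assoc _ a x ⟩
    inv a a≢0 * (a * x)  ≡⟨ cong (inv a a≢0 *_) ax≡ay ⟩
    inv a a≢0 * (a * y)  ≡⟨ sym (*-assoc _ a y) ⟩
    (inv a a≢0 * a) * y  ≡⟨ cong (_* y) (inv*x≡1 a a≢0) ⟩
    1# * y               ≡⟨ *-identityˡ y ⟩
    y                    ∎
    where open ≡-Reasoning

  x*y≡0⇒y≡0 : ∀ {x y} → x ≢ 0# → x * y ≡ 0# → y ≡ 0#
  x*y≡0⇒y≡0 {x} x≢0 xy≡0 = *-cancelˡ-≢0 x≢0 (trans xy≡0 (sym (zeroʳ x)))

  *-cancelʳ-≢0 : ∀ {a x y} → a ≢ 0# → x * a ≡ y * a → x ≡ y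
  *-cancelʳ-≢0 {a} {x} {y} a≢0 xa≡ya = *-cancelˡ-≢0 a≢0 (trans (*-comm a x) (trans xa≡ya (*-comm y a)))

  *-≢0 : ∀ {x y} → x ≢ 0# → y ≢ 0# → x * y ≢ 0#
  *-≢0 x≢0 y≢0 = y≢0 ∘ x*y≡0⇒y≡0 x≢0

  inv-≢0 : ∀ x (x≢0 : x ≢ 0#) → inv x x≢0 ≢ 0#
  inv-≢0 x x≢0 inv≡0 = 0≢1 (begin
    0#                  ≡⟨ sym (zeroʳ x) ⟩
    x * 0#              ≡⟨ cong (x *_) (sym inv≡0) ⟩
    x * inv x x≢0       ≡⟨ x*inv≡1 x x≢0 ⟩
    1#                  ∎)
    where open ≡-Reasoning

  x*z≡y*z⇒z≡0 : ∀ {x y z} → x ≢ y → x * z ≡ y * z → z ≡ 0#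
  x*z≡y*z⇒z≡0 {x} {y} {z} x≢y xz≡yz =
    x*y≡0⇒y≡0 (x≢y ∘ x∙y⁻¹≈ε⇒x≈y x y) (trans ([y-z]x≈yx-zx z x y) (x≈y⇒x∙y⁻¹≈ε xz≡yz))

module Vectors (F : Field) (q : ℕ) where

  open FieldProperties F
  open Geometry F q
  open ≡-Reasoning

  sumFin-cong : ∀ {n} {f g : Fin n → K} → (∀ i → f i ≡ g i) → sumFin f ≡ sumFin g
  sumFin-cong {zero}  f≗g = refl
  sumFin-cong {suc n} f≗g = cong₂ _+_ (f≗g zero) (sumFin-cong (f≗g ∘ suc))

  sumFin-zero : ∀ {n} {f : Fin n → K} → (∀ i → f i ≡ 0#) → sumFin f ≡ 0#
  sumFin-zero {zero}  f≗0 = refl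
  sumFin-zero {suc n} f≗0 = trans (cong₂ _+_ (f≗0 zero) (sumFin-zero (f≗0 ∘ suc))) (+-identityʳ 0#)

  sumFin-+ : ∀ {n} (f g : Fin n → K) → sumFin (λ i → f i + g i) ≡ sumFin f + sumFin g
  sumFin-+ {zero}  f g = sym (+-identityʳ 0#)
  sumFin-+ {suc n} f g = trans (cong (f zero + g zero +_) (sumFin-+ (f ∘ suc) (g ∘ suc))) (+-interchange _ _ _ _)

  sumFin-*ˡ : ∀ {n} c (f : Fin n → K) → c * sumFin f ≡ sumFin (λ i → c * f i)
  sumFin-*ˡ {zero}  c f = zeroʳ c
  sumFin-*ˡ {suc n} c f = trans (distribˡ c _ _) (cong (c * f zero +_) (sumFin-*ˡ c (f ∘ suc)))

  sumFin-*ʳ : ∀ {n} c (f : Fin n → K) → sumFin f * c ≡ sumFin (λ i → f i * c)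
  sumFin-*ʳ c f = trans (*-comm _ c) (trans (sumFin-*ˡ c f) (sumFin-cong (λ i → *-comm c (f i))))

  sumFin-swap : ∀ {m n} (f : Fin m → Fin n → K) →
             sumFin (λ i → sumFin (f i)) ≡ sumFin (λ j → sumFin (λ i → f i j))
  sumFin-swap {zero}  {n} f = sym (sumFin-zero {n} (λ _ → refl))
  sumFin-swap {suc m} {n} f = begin
    sumFin (f zero) + sumFin (λ i → sumFin (f (suc i)))
      ≡⟨ cong (sumFin (f zero) +_) (sumFin-swap (f ∘ suc)) ⟩
    sumFin (f zero) + sumFin (λ j → sumFin (λ i → f (suc i) j))
      ≡⟨ sym (sumFin-+ (f zero) (λ j → sumFin (λ i → f (suc i) j))) ⟩
    sumFin (λ j → f zero j + sumFin (λ i → f (suc i) j)) ∎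

  sumFin-bilinear : ∀ {k l} (c : Fin k → K) (A : Fin k → Fin l → K) (e : Fin l → K) →
    sumFin (λ i → c i * sumFin (λ j → A i j * e j)) ≡ sumFin (λ j → sumFin (λ i → c i * A i j) * e j)
  sumFin-bilinear c A e = begin
    sumFin (λ i → c i * sumFin (λ j → A i j * e j))     ≡⟨ sumFin-cong (λ i → sumFin-*ˡ (c i) (λ j → A i j * e j)) ⟩
    sumFin (λ i → sumFin (λ j → c i * (A i j * e j)))   ≡⟨ sumFin-swap (λ i j → c i * (A i j * e j)) ⟩
    sumFin (λ j → sumFin (λ i → c i * (A i j * e j)))   ≡⟨ sumFin-cong (λ j → trans (sumFin-cong (λ i → sym (*-assoc (c i) (A i j) (e j))))
                                                                                    (sym (sumFin-*ʳ (e j) (λ i → c i * A i j)))) ⟩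
    sumFin (λ j → sumFin (λ i → c i * A i j) * e j)     ∎

  sumFin-punchIn : ∀ {n} (f : Fin (suc n) → K) k → sumFin f ≡ f k + sumFin (f ∘ punchIn k)
  sumFin-punchIn {n}     f zero    = refl
  sumFin-punchIn {suc n} f (suc k) = begin
    f zero + sumFin (f ∘ suc)
      ≡⟨ cong (f zero +_) (sumFin-punchIn (f ∘ suc) k) ⟩
    f zero + (f (suc k) + sumFin (f ∘ suc ∘ punchIn k))
      ≡⟨ +-exchange (f zero) (f (suc k)) _ ⟩
    f (suc k) + (f zero + sumFin (f ∘ suc ∘ punchIn k)) ∎

  sumFin-++ : ∀ a {b} (f : Fin (a ℕ.+ b) → K) → sumFin f ≡ sumFin (f ∘ (_↑ˡ b)) + sumFin (f ∘ (a ↑ʳ_))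
  sumFin-++ zero    f = sym (+-identityˡ _)
  sumFin-++ (suc a) f = trans (cong (f zero +_) (sumFin-++ a (f ∘ suc))) (sym (+-assoc _ _ _))

  unitVec : ∀ {n} → Fin n → Vect n
  unitVec i t with t Fin.≟ i
  ... | yes _ = 1#
  ... | no  _ = 0#

  unitVec-self : ∀ {n} (i : Fin n) → unitVec i i ≡ 1#
  unitVec-self i with i Fin.≟ i
  ... | yes _   = refl
  ... | no  i≢i = contradiction refl i≢i

  sumFin-unitVec : ∀ {n} i (f : Fin (suc n) → K) → sumFin (λ t → unitVec i t * f t) ≡ f i
  sumFin-unitVec i f = begin
    sumFin (λ t → unitVec i t * f t)
      ≡⟨ sumFin-punchIn (λ t → unitVec i t * f t) i ⟩
    unitVec i i * f i + sumFin (λ t → unitVec i (punchIn i t) * f (punchIn i t))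
      ≡⟨ cong₂ (λ a b → a * f i + b) (unitVec-self i) (sumFin-zero (λ t → unitVec-other (punchIn i t) (Fin.punchInᵢ≢i i t))) ⟩
    1# * f i + 0#
      ≡⟨ trans (+-identityʳ _) (*-identityˡ _) ⟩
    f i ∎
    where
    unitVec-other : ∀ t → t ≢ i → unitVec i t * f t ≡ 0#
    unitVec-other t t≢i with t Fin.≟ i
    ... | yes t≡i = contradiction t≡i t≢i
    ... | no  _   = zeroˡ (f t)

  comb-cong : ∀ {k m} {c d : Fin k → K} (b : Fin k → Vect m) → (∀ i → c i ≡ d i) → ∀ j → comb c b j ≡ comb d b j
  comb-cong b c≗d j = sumFin-cong (λ i → cong (_* b i j) (c≗d i))

  comb-zero : ∀ {k m} (b : Fin k → Vect m) j → comb (λ _ → 0#) b j ≡ 0#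
  comb-zero b j = sumFin-zero (λ i → zeroˡ (b i j))

  comb-+ : ∀ {k m} (c d : Fin k → K) (b : Fin k → Vect m) j →
           comb (λ i → c i + d i) b j ≡ comb c b j + comb d b j
  comb-+ c d b j = trans (sumFin-cong (λ i → distribʳ (b i j) (c i) (d i))) (sumFin-+ (λ i → c i * b i j) (λ i → d i * b i j))

  comb-* : ∀ {k m} a (c : Fin k → K) (b : Fin k → Vect m) j → comb (λ i → a * c i) b j ≡ a * comb c b j
  comb-* a c b j = trans (sumFin-cong (λ i → *-assoc a (c i) (b i j))) (sym (sumFin-*ˡ a (λ i → c i * b i j)))

  comb-neg : ∀ {k m} (c : Fin k → K) (b : Fin k → Vect m) j → comb (λ i → - c i) b j ≡ - comb c b j
  comb-neg c b j = begin
    comb (λ i → - c i) b j      ≡⟨ comb-cong b (λ i → sym (-1*x≈-x (c i))) j ⟩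
    comb (λ i → - 1# * c i) b j ≡⟨ comb-* (- 1#) c b j ⟩
    - 1# * comb c b j           ≡⟨ -1*x≈-x _ ⟩
    - comb c b j                ∎

  comb-++ : ∀ {a b m} (c : Fin (a ℕ.+ b) → K) (u : Fin a → Vect m) (w : Fin b → Vect m) j →
            comb c (u V.++ w) j ≡ comb (c ∘ (_↑ˡ b)) u j + comb (c ∘ (a ↑ʳ_)) w j
  comb-++ {a} {b} c u w j = trans (sumFin-++ a _)
    (cong₂ _+_ (sumFin-cong (λ i → cong (λ x → c (i ↑ˡ b) * x j) (V.lookup-++ˡ u w i)))
               (sumFin-cong (λ i → cong (λ x → c (a ↑ʳ i) * x j) (V.lookup-++ʳ u w i))))

  infixl 6 _+ᵛ_
  infixr 7 _·ᵛ_

  _+ᵛ_ : ∀ {m} → Vect m → Vect m → Vect m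
  u +ᵛ v = λ j → u j + v j

  _·ᵛ_ : ∀ {m} → K → Vect m → Vect m
  a ·ᵛ u = λ j → a * u j

  ~-sym : ∀ {m} {u v : Vect m} → u ~ v → v ~ u
  ~-sym {v = v} (k , k≢0 , u≗kv) = inv k k≢0 , inv-≢0 k k≢0 , λ j → sym (begin
    inv k k≢0 * _           ≡⟨ cong (inv k k≢0 *_) (u≗kv j) ⟩
    inv k k≢0 * (k * v j)   ≡⟨ sym (*-assoc _ k (v j)) ⟩
    inv k k≢0 * k * v j     ≡⟨ cong (_* v j) (inv*x≡1 k k≢0) ⟩
    1# * v j                ≡⟨ *-identityˡ (v j) ⟩
    v j                     ∎)

  ~-trans : ∀ {m} {u v w : Vect m} → u ~ v → v ~ w → u ~ w
  ~-trans {w = w} (k , k≢0 , u≗kv) (l , l≢0 , v≗lw) =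
    k * l , *-≢0 k≢0 l≢0 , λ j → trans (u≗kv j) (trans (cong (k *_) (v≗lw j)) (sym (*-assoc k l (w j))))

  ~-nonZero : ∀ {m} {u v : Vect m} → NonZero v → u ~ v → NonZero u
  ~-nonZero v≢0 (k , k≢0 , u≗kv) u≗0 = v≢0 (λ j → x*y≡0⇒y≡0 k≢0 (trans (sym (u≗kv j)) (u≗0 j)))

  record IsLinearSubset {m} (S : Vect m → Set) : Set where
    field
      ∈-resp-≗ : S Respects _≗_
      0∈       : S (λ _ → 0#)
      +-closed : ∀ {u v} → S u → S v → S (u +ᵛ v)
      *-closed : ∀ a {u} → S u → S (a ·ᵛ u)

    ~-closed : ∀ {u v} → S v → u ~ v → S u
    ~-closed Sv (k , _ , u≗kv) = ∈-resp-≗ (λ j → sym (u≗kv j)) (*-closed k Sv)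

  Any⇒nonzero-∩ : ∀ {m} {S T : Vect m → Set} {L} → EnumeratesPoints S L → Any T L → ∃[ v ] NonZero v × S v × T v
  Any⇒nonzero-∩ (L≢0 , L⊆S , _ , _) ∃v = let (v , v∈L , Tv) = find ∃v in v , All.lookup L≢0 v∈L , All.lookup L⊆S v∈L , Tv

  nonzero-∩⇒Any : ∀ {m} {S T : Vect m → Set} {L} → EnumeratesPoints S L → (∀ {u v} → T v → u ~ v → T u) →
                  ∃[ v ] NonZero v × S v × T v → Any T L
  nonzero-∩⇒Any (_ , _ , _ , L-covers) T-~ (v , v≢0 , Sv , Tv) = Any.map (λ v~w → T-~ Tv (~-sym v~w)) (L-covers v v≢0 Sv)

  ∩-linear : ∀ {m} {S T : Vect m → Set} → IsLinearSubset S → IsLinearSubset T →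
             IsLinearSubset (λ v → S v × T v)
  ∩-linear S T = record
    { ∈-resp-≗ = λ u≗v (Su , Tu) → S.∈-resp-≗ u≗v Su , T.∈-resp-≗ u≗v Tu
    ; 0∈       = S.0∈ , T.0∈
    ; +-closed = λ (Su , Tu) (Sv , Tv) → S.+-closed Su Sv , T.+-closed Tu Tv
    ; *-closed = λ a (Su , Tu) → S.*-closed a Su , T.*-closed a Tu
    }
    where
    module S = IsLinearSubset S
    module T = IsLinearSubset T

  span-linear : ∀ {k m} (b : Fin k → Vect m) → IsLinearSubset (InSpan b)
  span-linear b = record
    { ∈-resp-≗ = λ u≗v (c , u≗cb) → c , (λ j → trans (sym (u≗v j)) (u≗cb j))
    ; 0∈       = (λ _ → 0#) , (λ j → sym (comb-zero b j))
    ; +-closed = λ (c , u≗cb) (d , v≗db) → (λ i → c i + d i) ,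
                   (λ j → trans (cong₂ _+_ (u≗cb j) (v≗db j)) (sym (comb-+ c d b j)))
    ; *-closed = λ a (c , u≗cb) → (λ i → a * c i) , (λ j → trans (cong (a *_) (u≗cb j)) (sym (comb-* a c b j)))
    }

  basis∈span : ∀ {k m} (b : Fin (suc k) → Vect m) i → InSpan b (b i)
  basis∈span b i = unitVec i , (λ j → sym (sumFin-unitVec i (λ t → b t j)))

  pow-* : ∀ x y k → pow (x * y) k ≡ pow x k * pow y k
  pow-* x y zero    = sym (*-identityˡ 1#)
  pow-* x y (suc k) = trans (cong ((x * y) *_) (pow-* x y k)) (*-interchange x y _ _)

  pow-+ : ∀ x a b → pow x (a ℕ.+ b) ≡ pow x a * pow x b
  pow-+ x zero    b = sym (*-identityˡ _)
  pow-+ x (suc a) b = trans (cong (x *_) (pow-+ x a b)) (sym (*-assoc _ _ _))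

  pow-pow : ∀ x a b → pow x (a ℕ.* b) ≡ pow (pow x a) b
  pow-pow x a zero    = cong (pow x) (ℕ.*-zeroʳ a)
  pow-pow x a (suc b) = begin
    pow x (a ℕ.* suc b)       ≡⟨ cong (pow x) (ℕ.*-suc a b) ⟩
    pow x (a ℕ.+ a ℕ.* b)     ≡⟨ pow-+ x a (a ℕ.* b) ⟩
    pow x a * pow x (a ℕ.* b) ≡⟨ cong (pow x a *_) (pow-pow x a b) ⟩
    pow x a * pow (pow x a) b ∎

  pow-1# : ∀ k → pow 1# k ≡ 1#
  pow-1# zero    = refl
  pow-1# (suc k) = trans (*-identityˡ _) (pow-1# k)

  pow-0# : ∀ k → 0 < k → pow 0# k ≡ 0#
  pow-0# (suc k) _ = zeroˡ (pow 0# k)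

  pow-≢0 : ∀ {x} k → x ≢ 0# → pow x k ≢ 0#
  pow-≢0 zero    x≢0 = 1≢0
  pow-≢0 (suc k) x≢0 = *-≢0 x≢0 (pow-≢0 k x≢0)

  sumFin-last : ∀ {n} (f : Fin (suc n) → K) → sumFin f ≡ sumFin (f ∘ Fin.inject₁) + f (Fin.fromℕ n)
  sumFin-last {zero}  f = +-comm (f zero) 0#
  sumFin-last {suc n} f = trans (cong (f zero +_) (sumFin-last (f ∘ suc))) (sym (+-assoc _ _ _))

  open SemiringMultiplication (CommutativeRing.semiring commRing) using (×-assoc-*; ×-congʳ) renaming (_×_ to _×ᴷ_)
  open SemiringSum (CommutativeRing.semiring commRing) using () renaming (sum to sumᴷ)
  open SemiringExponentiation (CommutativeRing.semiring commRing) using () renaming (_^_ to _^ᴷ_)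

  ^ᴷ≡pow : ∀ x k → x ^ᴷ k ≡ pow x k
  ^ᴷ≡pow x zero    = refl
  ^ᴷ≡pow x (suc k) = cong (x *_) (^ᴷ≡pow x k)

  sumᴷ≡sumFin : ∀ {k} (f : Fin k → K) → sumᴷ f ≡ sumFin f
  sumᴷ≡sumFin {zero}  f = refl
  sumᴷ≡sumFin {suc k} f = cong (f zero +_) (sumᴷ≡sumFin (f ∘ suc))

  ×ᴷ≡fromℕ* : ∀ k x → k ×ᴷ x ≡ fromℕ k * x
  ×ᴷ≡fromℕ* k x = sym (trans (×-assoc-* k 1# x) (×-congʳ k (*-identityˡ x)))

  freshman's-dream : ∀ {n} → 1 < n → (∀ {k} → 0 < k → k < n → fromℕ (n C k) ≡ 0#) →
                     ∀ x y → pow (x + y) n ≡ pow x n + pow y n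
  freshman's-dream {suc zero} (s≤s ()) _ x y
  freshman's-dream {suc (suc n)} _ nCk≡0 x y = begin
    pow (x + y) N                                  ≡⟨ sym (^ᴷ≡pow (x + y) N) ⟩
    (x + y) ^ᴷ N                                   ≡⟨ Binomial.theorem (*-comm x y) N ⟩
    Binomial.binomialExpansion N                   ≡⟨ sumᴷ≡sumFin T ⟩
    T zero + sumFin (T ∘ suc)                      ≡⟨ cong (T zero +_) (sumFin-last (T ∘ suc)) ⟩
    T zero + (sumFin (T ∘ suc ∘ Fin.inject₁) + T (suc (Fin.fromℕ (suc n))))
      ≡⟨ cong (λ s → T zero + (s + T (suc (Fin.fromℕ (suc n))))) (sumFin-zero inner-term≡0) ⟩
    T zero + (0# + T (suc (Fin.fromℕ (suc n))))    ≡⟨ cong₂ _+_ first-term (trans (+-identityˡ _) last-term) ⟩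
    pow y N + pow x N                              ≡⟨ +-comm _ _ ⟩
    pow x N + pow y N                              ∎
    where
    N = suc (suc n)
    module Binomial = BinomialTheorem (CommutativeRing.semiring commRing) x y
    T = Binomial.binomialTerm N
    first-term : T zero ≡ pow y N
    first-term = trans (+-identityʳ _) (trans (*-identityˡ _) (^ᴷ≡pow y N))
    last-term : T (suc (Fin.fromℕ (suc n))) ≡ pow x N
    last-term = term-at-N _ (cong suc (Fin.toℕ-fromℕ (suc n)))
      where
      term-at-N : ∀ t → t ≡ N → (N C t) ×ᴷ (x ^ᴷ t * y ^ᴷ (N ℕ.∸ t)) ≡ pow x N
      term-at-N _ refl = begin
        (N C N) ×ᴷ (x ^ᴷ N * y ^ᴷ (N ℕ.∸ N)) ≡⟨ cong (_×ᴷ (x ^ᴷ N * y ^ᴷ (N ℕ.∸ N))) (nCn≡1 N) ⟩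
        x ^ᴷ N * y ^ᴷ (N ℕ.∸ N) + 0#         ≡⟨ +-identityʳ _ ⟩
        x ^ᴷ N * y ^ᴷ (N ℕ.∸ N)              ≡⟨ cong (λ e → x ^ᴷ N * y ^ᴷ e) (ℕ.n∸n≡0 N) ⟩
        x ^ᴷ N * 1#                          ≡⟨ *-identityʳ _ ⟩
        x ^ᴷ N                               ≡⟨ ^ᴷ≡pow x N ⟩
        pow x N                              ∎
    inner-term≡0 : ∀ j → T (suc (Fin.inject₁ j)) ≡ 0#
    inner-term≡0 j = trans (×ᴷ≡fromℕ* (N C suc (Fin.toℕ (Fin.inject₁ j))) (Binomial.binomial N (suc (Fin.inject₁ j))))
                           (trans (cong (_* Binomial.binomial N (suc (Fin.inject₁ j))) (nCk≡0 (s≤s z≤n) (s≤s inner)))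
                                  (zeroˡ _))
      where
      inner : Fin.toℕ (Fin.inject₁ j) < suc n
      inner = subst (_< suc n) (sym (Fin.toℕ-inject₁ j)) (Fin.toℕ<n j)

  herm-congˡ : ∀ {m} {u u′ : Vect m} w → (∀ j → u j ≡ u′ j) → herm u w ≡ herm u′ w
  herm-congˡ w u≗u′ = sumFin-cong (λ j → cong (_* conj (w j)) (u≗u′ j))

  herm-congʳ : ∀ {m} (u : Vect m) {w w′} → (∀ j → w j ≡ w′ j) → herm u w ≡ herm u w′
  herm-congʳ u w≗w′ = sumFin-cong (λ j → cong (λ x → u j * conj x) (w≗w′ j))

  herm-zeroˡ : ∀ {m} {u : Vect m} w → (∀ j → u j ≡ 0#) → herm u w ≡ 0#
  herm-zeroˡ w u≗0 = sumFin-zero (λ j → trans (cong (_* conj (w j)) (u≗0 j)) (zeroˡ _))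

  herm-*ˡ : ∀ {m} a (u w : Vect m) → herm (a ·ᵛ u) w ≡ a * herm u w
  herm-*ˡ a u w = trans (sumFin-cong (λ j → *-assoc a (u j) _)) (sym (sumFin-*ˡ a (λ j → u j * conj (w j))))

  herm-*ʳ : ∀ {m} a (u w : Vect m) → herm u (a ·ᵛ w) ≡ conj a * herm u w
  herm-*ʳ a u w = begin
    sumFin (λ j → u j * conj (a * w j))
      ≡⟨ sumFin-cong (λ j → trans (cong (u j *_) (pow-* a (w j) q)) (*-exchange (u j) (conj a) _)) ⟩
    sumFin (λ j → conj a * (u j * conj (w j)))
      ≡⟨ sym (sumFin-*ˡ (conj a) (λ j → u j * conj (w j))) ⟩
    conj a * herm u w ∎

  herm-+ˡ : ∀ {m} (u v w : Vect m) → herm (u +ᵛ v) w ≡ herm u w + herm v w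
  herm-+ˡ u v w = trans (sumFin-cong (λ j → distribʳ _ (u j) (v j))) (sumFin-+ (λ j → u j * conj (w j)) (λ j → v j * conj (w j)))

  herm-combˡ : ∀ {k m} (c : Fin k → K) (b : Fin k → Vect m) w →
               herm (comb c b) w ≡ sumFin (λ i → c i * herm (b i) w)
  herm-combˡ c b w = begin
    sumFin (λ j → comb c b j * conj (w j))
      ≡⟨ sumFin-cong (λ j → sumFin-*ʳ (conj (w j)) (λ i → c i * b i j)) ⟩
    sumFin (λ j → sumFin (λ i → c i * b i j * conj (w j)))
      ≡⟨ sumFin-swap (λ j i → c i * b i j * conj (w j)) ⟩
    sumFin (λ i → sumFin (λ j → c i * b i j * conj (w j)))
      ≡⟨ sumFin-cong (λ i → trans (sumFin-cong (λ j → *-assoc (c i) (b i j) _)) (sym (sumFin-*ˡ (c i) (λ j → b i j * conj (w j))))) ⟩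
    sumFin (λ i → c i * herm (b i) w) ∎

  herm-unitVecˡ : ∀ {n} i (w : Vect (suc n)) → herm (unitVec i) w ≡ conj (w i)
  herm-unitVecˡ i w = sumFin-unitVec i (λ j → conj (w j))

  ⊥-basis⇒⊥-span : ∀ {k m} (b : Fin k → Vect m) {u w} → (∀ i → herm (b i) w ≡ 0#) → InSpan b u → herm u w ≡ 0#
  ⊥-basis⇒⊥-span b {w = w} b⊥w (c , u≗cb) = begin
    herm _ w                          ≡⟨ herm-congˡ w u≗cb ⟩
    herm (comb c b) w                 ≡⟨ herm-combˡ c b w ⟩
    sumFin (λ i → c i * herm (b i) w) ≡⟨ sumFin-zero (λ i → trans (cong (c i *_) (b⊥w i)) (zeroʳ (c i))) ⟩
    0#                                ∎

module Counting where

  open ≡-Reasoning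
  open import Data.Integer using (+_)
  open CommutativeSemigroupProperties ℕ.+-commutativeSemigroup using (interchange)

  private variable A B C : Set

  scaled-differences-add : ∀ α x y X Y → α ℤ.* (x ℤ.- y) ℤ.+ α ℤ.* (X ℤ.- Y) ≡ α ℤ.* ((x ℤ.+ X) ℤ.- (y ℤ.+ Y))
  scaled-differences-add = ℤ-solve-∀

  ∑ : {A : Set} → List A → (A → ℕ) → ℕ
  ∑ xs f = sum (map f xs)

  syntax ∑ xs (λ x → e) = ∑[ x ∈ xs ] e

  𝟙 : {P : Set} → Dec P → ℕ
  𝟙 (yes _) = 1
  𝟙 (no  _) = 0

  𝟙-yes : ∀ {P : Set} (P? : Dec P) → P → 𝟙 P? ≡ 1
  𝟙-yes (yes _) _ = refl
  𝟙-yes (no ¬p) p = contradiction p ¬p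

  𝟙-no : ∀ {P : Set} (P? : Dec P) → ¬ P → 𝟙 P? ≡ 0
  𝟙-no (yes p) ¬p = contradiction p ¬p
  𝟙-no (no  _) _  = refl

  𝟙-cong : ∀ {P R : Set} (P? : Dec P) (R? : Dec R) → (P → R) → (R → P) → 𝟙 P? ≡ 𝟙 R?
  𝟙-cong P? (yes r) _   R→P = 𝟙-yes P? (R→P r)
  𝟙-cong P? (no ¬r) P→R _   = 𝟙-no P? (¬r ∘ P→R)

  ∑-cong : ∀ {f g : A → ℕ} xs → (∀ {x} → x ∈ xs → f x ≡ g x) → ∑ xs f ≡ ∑ xs g
  ∑-cong []       f≗g = refl
  ∑-cong (x ∷ xs) f≗g = cong₂ ℕ._+_ (f≗g (here refl)) (∑-cong xs (f≗g ∘ there))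

  ∑-zero : ∀ {f : A → ℕ} xs → (∀ {x} → x ∈ xs → f x ≡ 0) → ∑ xs f ≡ 0
  ∑-zero []       f≗0 = refl
  ∑-zero (x ∷ xs) f≗0 = cong₂ ℕ._+_ (f≗0 (here refl)) (∑-zero xs (f≗0 ∘ there))

  ∑-+ : ∀ (f g : A → ℕ) xs → ∑[ x ∈ xs ] (f x ℕ.+ g x) ≡ ∑ xs f ℕ.+ ∑ xs g
  ∑-+ f g []       = refl
  ∑-+ f g (x ∷ xs) = trans (cong (f x ℕ.+ g x ℕ.+_) (∑-+ f g xs)) (interchange (f x) (g x) _ _)

  ∑-const : ∀ c (xs : List A) → ∑[ _ ∈ xs ] c ≡ c ℕ.* length xs
  ∑-const c []       = sym (ℕ.*-zeroʳ c)
  ∑-const c (x ∷ xs) = trans (cong (c ℕ.+_) (∑-const c xs)) (sym (ℕ.*-suc c (length xs)))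

  ∑-↭ : ∀ (f : A → ℕ) {xs ys} → xs ↭ ys → ∑ xs f ≡ ∑ ys f
  ∑-↭ f xs↭ys = sum-↭ (↭.map⁺ f xs↭ys)

  ∑-map : ∀ (f : B → ℕ) (g : A → B) xs → ∑ (map g xs) f ≡ ∑ xs (f ∘ g)
  ∑-map f g xs = cong sum (sym (List.map-∘ xs))

  ∑-single : ∀ (f : A → ℕ) {xs a} → Unique xs → a ∈ xs → (∀ {x} → x ≢ a → f x ≡ 0) → ∑ xs f ≡ f a
  ∑-single f {x ∷ xs} (x∉xs ∷ _)   (here refl) f≡0 =
    trans (cong (f x ℕ.+_) (∑-zero xs (λ y∈xs → f≡0 (λ y≡x → All.lookup x∉xs y∈xs (sym y≡x))))) (ℕ.+-identityʳ _)
  ∑-single f {x ∷ xs} (x∉xs ∷ xs!) (there a∈xs) f≡0 =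
    cong₂ ℕ._+_ (f≡0 (λ x≡a → All.lookup x∉xs a∈xs x≡a)) (∑-single f xs! a∈xs f≡0)

  ∑-𝟙+∑-𝟙¬ : ∀ {P : A → Set} (P? : ∀ x → Dec (P x)) xs →
             ∑[ x ∈ xs ] 𝟙 (P? x) ℕ.+ ∑[ x ∈ xs ] 𝟙 (Dec.¬? (P? x)) ≡ length xs
  ∑-𝟙+∑-𝟙¬ P? xs = begin
    ∑[ x ∈ xs ] 𝟙 (P? x) ℕ.+ ∑[ x ∈ xs ] 𝟙 (Dec.¬? (P? x)) ≡⟨ sym (∑-+ _ _ xs) ⟩
    ∑[ x ∈ xs ] (𝟙 (P? x) ℕ.+ 𝟙 (Dec.¬? (P? x)))          ≡⟨ ∑-cong xs (λ {x} _ → 𝟙+𝟙¬ (P? x)) ⟩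
    ∑[ _ ∈ xs ] 1                                          ≡⟨ ∑-const 1 xs ⟩
    1 ℕ.* length xs                                        ≡⟨ ℕ.*-identityˡ _ ⟩
    length xs                                              ∎
    where
    𝟙+𝟙¬ : ∀ {P : Set} (P? : Dec P) → 𝟙 P? ℕ.+ 𝟙 (Dec.¬? P?) ≡ 1
    𝟙+𝟙¬ (yes _) = refl
    𝟙+𝟙¬ (no  _) = refl

  length-filter≡∑𝟙 : ∀ {P : A → Set} (P? : ∀ x → Dec (P x)) xs → length (List.filter P? xs) ≡ ∑[ x ∈ xs ] 𝟙 (P? x)
  length-filter≡∑𝟙 P? []       = refl
  length-filter≡∑𝟙 P? (x ∷ xs) with P? x
  ... | yes _ = cong suc (length-filter≡∑𝟙 P? xs)
  ... | no  _ = length-filter≡∑𝟙 P? xs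

  ∑ℤ-scaled-difference : ∀ (α : ℤ) (f g : A → ℤ) (a b : A → ℕ) xs →
    (∀ {x} → x ∈ xs → f x ≡ + a x) → (∀ {x} → x ∈ xs → g x ≡ + b x) →
    List.foldr ℤ._+_ (+ 0) (map (λ x → α ℤ.* (f x ℤ.- g x)) xs) ≡ α ℤ.* (+ ∑ xs a ℤ.- + ∑ xs b)
  ∑ℤ-scaled-difference α f g a b []       _   _   = sym (ℤ.*-zeroʳ α)
  ∑ℤ-scaled-difference α f g a b (x ∷ xs) f≡a g≡b = begin
    α ℤ.* (f x ℤ.- g x) ℤ.+ List.foldr ℤ._+_ (+ 0) (map (λ x → α ℤ.* (f x ℤ.- g x)) xs)
      ≡⟨ cong₂ (λ s t → α ℤ.* (s ℤ.- t) ℤ.+ List.foldr ℤ._+_ (+ 0) (map (λ x → α ℤ.* (f x ℤ.- g x)) xs))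
               (f≡a (here refl)) (g≡b (here refl)) ⟩
    α ℤ.* (+ a x ℤ.- + b x) ℤ.+ List.foldr ℤ._+_ (+ 0) (map (λ x → α ℤ.* (f x ℤ.- g x)) xs)
      ≡⟨ cong (λ t → α ℤ.* (+ a x ℤ.- + b x) ℤ.+ t) (∑ℤ-scaled-difference α f g a b xs (f≡a ∘ there) (g≡b ∘ there)) ⟩
    α ℤ.* (+ a x ℤ.- + b x) ℤ.+ α ℤ.* (+ ∑ xs a ℤ.- + ∑ xs b)
      ≡⟨ scaled-differences-add α (+ a x) (+ b x) (+ ∑ xs a) (+ ∑ xs b) ⟩
    α ℤ.* ((+ a x ℤ.+ + ∑ xs a) ℤ.- (+ b x ℤ.+ + ∑ xs b))
      ≡⟨ sym (cong₂ (λ s t → α ℤ.* (s ℤ.- t)) (ℤ.pos-+ (a x) (∑ xs a)) (ℤ.pos-+ (b x) (∑ xs b))) ⟩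
    α ℤ.* (+ (a x ℕ.+ ∑ xs a) ℤ.- + (b x ℕ.+ ∑ xs b)) ∎

  ∑-swap : ∀ (f : A → B → ℕ) xs ys → ∑[ x ∈ xs ] ∑ ys (f x) ≡ ∑[ y ∈ ys ] ∑[ x ∈ xs ] f x y
  ∑-swap f []       ys = sym (∑-zero ys (λ _ → refl))
  ∑-swap f (x ∷ xs) ys = trans (cong (∑ ys (f x) ℕ.+_) (∑-swap f xs ys))
                               (sym (∑-+ (f x) (λ y → ∑[ x ∈ xs ] f x y) ys))

  ∑-cartesianProductWith : ∀ (f : C → ℕ) (g : A → B → C) xs ys →
    ∑ (cartesianProductWith g xs ys) f ≡ ∑[ x ∈ xs ] ∑[ y ∈ ys ] f (g x y)
  ∑-cartesianProductWith f g []       ys = refl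
  ∑-cartesianProductWith f g (x ∷ xs) ys = begin
    sum (map f (map (g x) ys ++ cartesianProductWith g xs ys))
      ≡⟨ cong sum (List.map-++ f (map (g x) ys) _) ⟩
    sum (map f (map (g x) ys) ++ map f (cartesianProductWith g xs ys))
      ≡⟨ sum-++ (map f (map (g x) ys)) _ ⟩
    ∑ (map (g x) ys) f ℕ.+ ∑ (cartesianProductWith g xs ys) f
      ≡⟨ cong₂ ℕ._+_ (cong sum (sym (List.map-∘ ys))) (∑-cartesianProductWith f g xs ys) ⟩
    ∑[ y ∈ ys ] f (g x y) ℕ.+ ∑[ x ∈ xs ] ∑[ y ∈ ys ] f (g x y) ∎

  ∑-𝟙-exactly-one : ∀ (R : A → A → Set) {P : A → Set} (P? : ∀ x → Dec (P x)) {xs} →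
    AllPairs (λ a b → ¬ R a b) xs → (∀ {a b} → P a → P b → R a b) → Any P xs → ∑[ x ∈ xs ] 𝟙 (P? x) ≡ 1
  ∑-𝟙-exactly-one R P? {x ∷ xs} (x≁xs ∷ _) P⇒R (here Px) =
    cong₂ ℕ._+_ (𝟙-yes (P? x) Px)
      (∑-zero xs (λ y∈xs → 𝟙-no (P? _) (λ Py → All.lookup x≁xs y∈xs (P⇒R Px Py))))
  ∑-𝟙-exactly-one R P? {x ∷ xs} (x≁xs ∷ xs!) P⇒R (there any) =
    cong₂ ℕ._+_ (𝟙-no (P? x) (λ Px → let (y , y∈xs , Py) = find any in All.lookup x≁xs y∈xs (P⇒R Px Py)))
      (∑-𝟙-exactly-one R P? xs! P⇒R any)

  ∈-remove : ∀ {x : A} {ys} → x ∈ ys → ∃[ ys′ ] length ys ≡ suc (length ys′) × (∀ {z} → z ∈ ys → z ≢ x → z ∈ ys′)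
  ∈-remove {ys = y ∷ ys} (here x≡y) =
    ys , refl , λ { (here z≡y) z≢x → contradiction (trans z≡y (sym x≡y)) z≢x ; (there z∈ys) _ → z∈ys }
  ∈-remove {ys = y ∷ ys} (there x∈ys) with ∈-remove x∈ys
  ... | ys′ , |ys|≡ , kept =
    y ∷ ys′ , cong suc |ys|≡ , λ { (here z≡y) _ → here z≡y ; (there z∈ys) z≢x → there (kept z∈ys z≢x) }

  Unique⇒length≤ : ∀ {xs ys : List A} → Unique xs → (∀ {x} → x ∈ xs → x ∈ ys) → length xs ≤ length ys
  Unique⇒length≤ {xs = []}     _            _     = z≤n
  Unique⇒length≤ {xs = x ∷ xs} (x∉xs ∷ xs!) xs⊆ys with ∈-remove (xs⊆ys (here refl))
  ... | ys′ , |ys|≡1+|ys′| , kept = subst (suc (length xs) ≤_) (sym |ys|≡1+|ys′|)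
        (s≤s (Unique⇒length≤ xs! (λ z∈xs → kept (xs⊆ys (there z∈xs)) (λ z≡x → All.lookup x∉xs z∈xs (sym z≡x)))))

  map-bijection-↭ : ∀ {xs : List A} {f : A → A} → Unique xs → (∀ x → x ∈ xs) →
                    (∀ {x y} → f x ≡ f y → x ≡ y) → (∀ y → ∃[ x ] f x ≡ y) → map f xs ↭ xs
  map-bijection-↭ {xs = xs} {f} xs! ∈xs f-injective f-surjective =
    ∼bag⇒↭ (unique∧set⇒bag (Unique.map⁺ f-injective xs!) xs! (mk⇔ (λ _ → ∈xs _) ∈-image))
    where
    ∈-image : ∀ {y} → y ∈ xs → y ∈ map f xs
    ∈-image {y} _ = let (x , fx≡y) = f-surjective y in subst (_∈ map f xs) fx≡y (∈-map⁺ f (∈xs x))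

module DecidableField (F : Field) (q : ℕ) (_≟_ : DecidableEquality (Field.K F)) where

  open FieldProperties F
  open Geometry F q
  open Vectors F q
  open ≡-Reasoning

  nonZero? : ∀ {m} (v : Vect m) → Dec (NonZero v)
  nonZero? v = Dec.¬? (Fin.all? (λ j → v j ≟ 0#))

  nonZero⇒∃≢0 : ∀ {m} {v : Vect m} → NonZero v → ∃[ j ] v j ≢ 0#
  nonZero⇒∃≢0 {v = v} v≢0 with Fin.any? (λ j → Dec.¬? (v j ≟ 0#))
  ... | yes ∃≢0 = ∃≢0
  ... | no  ∄≢0 = contradiction (λ j → Dec.decidable-stable (v j ≟ 0#) (λ vj≢0 → ∄≢0 (j , vj≢0))) v≢0

  module Elimination {k m} (A : Fin (suc k) → Fin (suc m) → K) (p : Fin (suc k)) (a≢0 : A p zero ≢ 0#) where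

    private
      a⁻¹ = inv (A p zero) a≢0

    -- multiplier clearing the first unknown of equation punchIn p i against the pivot equation p
    d : Fin k → K
    d i = - (A (punchIn p i) zero * a⁻¹)

    reduced : Fin k → Fin m → K
    reduced i j = A (punchIn p i) (suc j) + d i * A p (suc j)

    lift : (Fin m → K) → Fin (suc m) → K
    lift y′ zero    = - (a⁻¹ * sumFin (λ j → A p (suc j) * y′ j))
    lift y′ (suc j) = y′ j

    lift-solves : ∀ y′ → (∀ i → sumFin (λ j → reduced i j * y′ j) ≡ 0#) → ∀ i → sumFin (λ j → A i j * lift y′ j) ≡ 0#
    lift-solves y′ y′-solves = punchIn-cases (λ i → sumFin (λ j → A i j * lift y′ j) ≡ 0#) p pivot-row other-row
      where
      S : Fin (suc k) → K
      S i = sumFin (λ j → A i (suc j) * y′ j)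
      pivot-row : A p zero * lift y′ zero + S p ≡ 0#
      pivot-row = begin
        A p zero * - (a⁻¹ * S p) + S p   ≡⟨ cong (_+ S p) (sym (-‿distribʳ-* (A p zero) _)) ⟩
        - (A p zero * (a⁻¹ * S p)) + S p ≡⟨ cong (λ t → - t + S p) (sym (*-assoc (A p zero) a⁻¹ (S p))) ⟩
        - (A p zero * a⁻¹ * S p) + S p   ≡⟨ cong (λ t → - (t * S p) + S p) (x*inv≡1 (A p zero) a≢0) ⟩
        - (1# * S p) + S p               ≡⟨ cong (λ t → - t + S p) (*-identityˡ (S p)) ⟩
        - S p + S p                      ≡⟨ -‿inverseˡ (S p) ⟩
        0#                               ∎
      other-row : ∀ i → A (punchIn p i) zero * lift y′ zero + S (punchIn p i) ≡ 0#
      other-row i = begin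
        c * - (a⁻¹ * S p) + S (punchIn p i)  ≡⟨ cong (_+ S (punchIn p i)) c*y₀≡d*Sp ⟩
        d i * S p + S (punchIn p i)          ≡⟨ +-comm _ _ ⟩
        S (punchIn p i) + d i * S p          ≡⟨ cong (S (punchIn p i) +_) (sumFin-*ˡ (d i) (λ j → A p (suc j) * y′ j)) ⟩
        S (punchIn p i) + sumFin (λ j → d i * (A p (suc j) * y′ j))
          ≡⟨ sym (sumFin-+ (λ j → A (punchIn p i) (suc j) * y′ j) (λ j → d i * (A p (suc j) * y′ j))) ⟩
        sumFin (λ j → A (punchIn p i) (suc j) * y′ j + d i * (A p (suc j) * y′ j))
          ≡⟨ sumFin-cong (λ j → trans (cong (A (punchIn p i) (suc j) * y′ j +_) (sym (*-assoc (d i) (A p (suc j)) (y′ j))))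
                                      (sym (distribʳ (y′ j) (A (punchIn p i) (suc j)) (d i * A p (suc j))))) ⟩
        sumFin (λ j → reduced i j * y′ j)    ≡⟨ y′-solves i ⟩
        0#                                   ∎
        where
        c = A (punchIn p i) zero
        c*y₀≡d*Sp : c * - (a⁻¹ * S p) ≡ d i * S p
        c*y₀≡d*Sp = begin
          c * - (a⁻¹ * S p)   ≡⟨ sym (-‿distribʳ-* c _) ⟩
          - (c * (a⁻¹ * S p)) ≡⟨ cong -_ (sym (*-assoc c a⁻¹ (S p))) ⟩
          - (c * a⁻¹ * S p)   ≡⟨ -‿distribˡ-* _ (S p) ⟩
          d i * S p           ∎

  homogeneous-solution : ∀ k m → k ≤ m → (A : Fin k → Fin (suc m) → K) →
    ∃ λ (y : Vect (suc m)) → (∃[ j ] y j ≢ 0#) × (∀ i → sumFin (λ j → A i j * y j) ≡ 0#)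
  homogeneous-solution zero    m       _         A = (λ _ → 1#) , (zero , 1≢0) , λ ()
  homogeneous-solution (suc k) (suc m) (s≤s k≤m) A with Fin.any? (λ i → Dec.¬? (A i zero ≟ 0#))
  ... | no no-pivot = unitVec zero , (zero , subst (_≢ 0#) (sym (unitVec-self {suc (suc m)} zero)) 1≢0) , solves
    where
    solves : ∀ i → sumFin (λ j → A i j * unitVec zero j) ≡ 0#
    solves i = trans (trans (sumFin-cong (λ j → *-comm (A i j) (unitVec zero j))) (sumFin-unitVec zero (A i)))
                     (Dec.decidable-stable (A i zero ≟ 0#) (λ Ai0≢0 → no-pivot (i , Ai0≢0)))
  ... | yes (p , a≢0) = lift y′ , (suc (proj₁ y′≢0) , proj₂ y′≢0) , lift-solves y′ y′-solves
    where
    open Elimination A p a≢0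
    solution = homogeneous-solution k m k≤m reduced
    y′ = proj₁ solution
    y′≢0 = proj₁ (proj₂ solution)
    y′-solves = proj₂ (proj₂ solution)

module MonicPolynomial (F : Field) where

  open FieldProperties F
  open ≡-Reasoning

  -- a ∷ as stands for a + x·as and [] for 1, so cs is monic of degree length cs.
  eval : List K → K → K
  eval []       x = 1#
  eval (a ∷ as) x = a + x * eval as x

  -- quotient as r is the quotient of a ∷ as by x - r, whatever a is
  quotient : List K → K → List K
  quotient []       r = []
  quotient (b ∷ bs) r = eval (b ∷ bs) r ∷ quotient bs r

  length-quotient : ∀ as r → length (quotient as r) ≡ length as
  length-quotient []       r = refl
  length-quotient (b ∷ bs) r = cong suc (length-quotient bs r)

  division : ∀ a as r x →
    eval (a ∷ as) x + r * eval (quotient as r) x ≡ eval (a ∷ as) r + x * eval (quotient as r) x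
  division a []       r x = +-swapʳ a (x * 1#) (r * 1#)
  division a (b ∷ bs) r x = begin
    a + x * g + r * (c + x * h)      ≡⟨ cong (a + x * g +_) (trans (distribˡ r c (x * h)) (cong (r * c +_) (*-exchange r x h))) ⟩
    (a + x * g) + (r * c + x * (r * h)) ≡⟨ +-interchange a (x * g) (r * c) _ ⟩
    (a + r * c) + (x * g + x * (r * h)) ≡⟨ cong (a + r * c +_) (sym (distribˡ x g (r * h))) ⟩
    a + r * c + x * (g + r * h)      ≡⟨ cong (λ t → a + r * c + x * t) (division b bs r x) ⟩
    a + r * c + x * (c + x * h)      ∎
    where
    g = eval (b ∷ bs) x
    c = eval (b ∷ bs) r
    h = eval (quotient bs r) x

  roots≤degree : ∀ cs {rs} → Unique rs → All (λ r → eval cs r ≡ 0#) rs → length rs ≤ length cs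
  roots≤degree cs       {[]}     _             _               = z≤n
  roots≤degree []       {r ∷ rs} _             (1≡0 ∷ _)       = contradiction 1≡0 1≢0
  roots≤degree (a ∷ as) {r ∷ rs} (r∉rs ∷ rs!) (fr≡0 ∷ frs≡0) =
    s≤s (subst (length rs ≤_) (length-quotient as r)
               (roots≤degree (quotient as r) rs! (All.zipWith root-of-quotient (r∉rs , frs≡0))))
    where
    root-of-quotient : ∀ {s} → r ≢ s × eval (a ∷ as) s ≡ 0# → eval (quotient as r) s ≡ 0#
    root-of-quotient {s} (r≢s , fs≡0) = x*z≡y*z⇒z≡0 r≢s (begin
      r * eval (quotient as r) s                       ≡⟨ sym (+-identityˡ _) ⟩
      0# + r * eval (quotient as r) s                  ≡⟨ cong (λ t → t + r * eval (quotient as r) s) (sym fs≡0) ⟩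
      eval (a ∷ as) s + r * eval (quotient as r) s     ≡⟨ division a as r s ⟩
      eval (a ∷ as) r + s * eval (quotient as r) s     ≡⟨ cong (λ t → t + s * eval (quotient as r) s) fr≡0 ⟩
      0# + s * eval (quotient as r) s                  ≡⟨ +-identityˡ _ ⟩
      s * eval (quotient as r) s                       ∎)

module FiniteField (F : Field) (Q : ℕ) (ord : HasOrder F Q) (q : ℕ) where

  open FieldProperties F
  open HasOrder ord
  open Geometry F q
  open Vectors F q
  open Counting
  open ≡-Reasoning

  infix 4 _≟_
  _≟_ : DecidableEquality K
  x ≟ y = ≟-on unique (complete x) (complete y)
    where
    ≟-on : ∀ {xs} → Unique xs → ∀ {x y} → x ∈ xs → y ∈ xs → Dec (x ≡ y)
    ≟-on (_ ∷ _)      (here x≡a) (here y≡a)  = yes (trans x≡a (sym y≡a))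
    ≟-on (a∉xs ∷ _)   (here x≡a) (there y∈)  = no (λ x≡y → All.lookup a∉xs y∈ (trans (sym x≡a) x≡y))
    ≟-on (a∉xs ∷ _)   (there x∈) (here y≡a)  = no (λ x≡y → All.lookup a∉xs x∈ (trans (sym y≡a) (sym x≡y)))
    ≟-on (_ ∷ xs!)    (there x∈) (there y∈)  = ≟-on xs! x∈ y∈

  open DecidableField F q _≟_ public

  -- Translating every element by 1# permutes the field, so Q · 1# adds nothing to the sum of all elements.
  fromℕ-order≡0 : fromℕ Q ≡ 0#
  fromℕ-order≡0 = +-cancelˡ (sumK elems) (fromℕ Q) 0# (begin
    sumK elems + fromℕ Q              ≡⟨ cong (λ n → sumK elems + fromℕ n) (sym size) ⟩
    sumK elems + fromℕ (length elems) ≡⟨ sym (sumK-+1 elems) ⟩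
    sumK (map (_+ 1#) elems)          ≡⟨ sumK-↭ (map-bijection-↭ unique complete +1-injective +1-surjective) ⟩
    sumK elems                        ≡⟨ sym (+-identityʳ _) ⟩
    sumK elems + 0#                   ∎)
    where
    sumK : List K → K
    sumK = List.foldr _+_ 0#
    sumK-+1 : ∀ xs → sumK (map (_+ 1#) xs) ≡ sumK xs + fromℕ (length xs)
    sumK-+1 []       = sym (+-identityʳ 0#)
    sumK-+1 (x ∷ xs) = trans (cong (x + 1# +_) (sumK-+1 xs)) (+-interchange x 1# _ _)
    sumK-↭ : ∀ {xs ys} → xs ↭ ys → sumK xs ≡ sumK ys
    sumK-↭ xs↭ys = foldr-commMonoid (setoid K) +-isCommutativeMonoid (↭⇒↭ₛ xs↭ys)
    +1-injective : ∀ {x y} → x + 1# ≡ y + 1# → x ≡ y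
    +1-injective {x} {y} = +-cancelʳ 1# x y
    +1-surjective : ∀ y → ∃[ x ] x + 1# ≡ y
    +1-surjective y = y - 1# , trans (+-assoc y (- 1#) 1#) (trans (cong (y +_) (-‿inverseˡ 1#)) (+-identityʳ y))

  vectors : ∀ m → List (Vec K m)
  vectors zero    = [] ∷ []
  vectors (suc m) = cartesianProductWith _∷_ elems (vectors m)

  vectors-unique : ∀ m → Unique (vectors m)
  vectors-unique zero    = [] ∷ []
  vectors-unique (suc m) = Unique.cartesianProductWith⁺ _∷_ Vec.∷-injective unique (vectors-unique m)

  ∈-vectors : ∀ {m} (c : Vec K m) → c ∈ vectors m
  ∈-vectors []      = here refl
  ∈-vectors (x ∷ c) = ∈-cartesianProductWith⁺ _∷_ (complete x) (∈-vectors c)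

  lookup-injective : ∀ {m} {c d : Vec K m} → Vec.lookup c ≗ Vec.lookup d → c ≡ d
  lookup-injective {c = c} {d} c≗d =
    trans (sym (Vec.tabulate∘lookup c)) (trans (Vec.tabulate-cong c≗d) (Vec.tabulate∘lookup d))

  card : ∀ {m} {S : Vect m → Set} → (∀ v → Dec (S v)) → ℕ
  card {m} S? = ∑[ c ∈ vectors m ] 𝟙 (S? (Vec.lookup c))

  card-cong : ∀ {m} {S T : Vect m → Set} (S? : ∀ v → Dec (S v)) (T? : ∀ v → Dec (T v)) →
              (∀ {v} → S v → T v) → (∀ {v} → T v → S v) → card S? ≡ card T?
  card-cong {m} S? T? S⇒T T⇒S = ∑-cong (vectors m) (λ {c} _ → 𝟙-cong (S? (Vec.lookup c)) (T? (Vec.lookup c)) S⇒T T⇒S)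

  card-translate : ∀ {m} {S : Vect m → Set} → S Respects _≗_ → (S? : ∀ v → Dec (S v)) (t : Vect m) →
                   card (λ v → S? (v +ᵛ t)) ≡ card S?
  card-translate {m} {S} S-resp S? t = begin
    ∑[ c ∈ vectors m ] 𝟙 (S? (λ j → Vec.lookup c j + t j))
      ≡⟨ ∑-cong (vectors m) (λ {c} _ → 𝟙-cong (S? _) (S? _) (S-resp (λ j → sym (lookup-translate c j)))
                                                           (S-resp (lookup-translate c))) ⟩
    ∑[ c ∈ vectors m ] 𝟙 (S? (Vec.lookup (translate c)))
      ≡⟨ sym (∑-map (λ c → 𝟙 (S? (Vec.lookup c))) translate (vectors m)) ⟩
    ∑ (map translate (vectors m)) (λ c → 𝟙 (S? (Vec.lookup c)))
      ≡⟨ ∑-↭ _ (map-bijection-↭ (vectors-unique m) ∈-vectors translate-injective translate-surjective) ⟩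
    card S? ∎
    where
    translate : Vec K m → Vec K m
    translate c = Vec.tabulate (λ j → Vec.lookup c j + t j)
    lookup-translate : ∀ c j → Vec.lookup (translate c) j ≡ Vec.lookup c j + t j
    lookup-translate c = Vec.lookup∘tabulate _
    translate-injective : ∀ {c d} → translate c ≡ translate d → c ≡ d
    translate-injective {c} {d} tc≡td = lookup-injective (λ j → +-cancelʳ (t j) _ _
      (trans (sym (lookup-translate c j)) (trans (cong (λ e → Vec.lookup e j) tc≡td) (lookup-translate d j))))
    translate-surjective : ∀ d → ∃[ c ] translate c ≡ d
    translate-surjective d = c , lookup-injective (λ j → begin
      Vec.lookup (translate c) j                                ≡⟨ lookup-translate c j ⟩
      Vec.lookup (Vec.tabulate (λ j → Vec.lookup d j - t j)) j + t j
        ≡⟨ cong (_+ t j) (Vec.lookup∘tabulate _ j) ⟩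
      Vec.lookup d j - t j + t j                                ≡⟨ +-assoc _ (- t j) (t j) ⟩
      Vec.lookup d j + (- t j + t j)                            ≡⟨ cong (Vec.lookup d j +_) (-‿inverseˡ (t j)) ⟩
      Vec.lookup d j + 0#                                       ≡⟨ +-identityʳ _ ⟩
      Vec.lookup d j                                            ∎)
      where c = Vec.tabulate (λ j → Vec.lookup d j - t j)

  card-fibres : ∀ {m} {S : Vect (suc m) → Set} → S Respects _≗_ → (S? : ∀ v → Dec (S v)) →
                card S? ≡ ∑[ x ∈ elems ] card (λ w → S? (x V.∷ w))
  card-fibres {m} S-resp S? = trans (∑-cartesianProductWith _ _∷_ elems (vectors m))
    (∑-cong elems (λ _ → ∑-cong (vectors m) (λ _ → 𝟙-cong (S? _) (S? _) (S-resp lookup-∷) (S-resp (sym ∘ lookup-∷)))))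
    where
    lookup-∷ : ∀ {x} {c : Vec K m} → Vec.lookup (x ∷ c) ≗ x V.∷ Vec.lookup c
    lookup-∷ zero    = refl
    lookup-∷ (suc j) = refl

  tail-linear : ∀ {m} {S : Vect (suc m) → Set} → IsLinearSubset S → IsLinearSubset (λ w → S (0# V.∷ w))
  tail-linear S-lin = record
    { ∈-resp-≗ = λ u≗v → ∈-resp-≗ (λ { zero → refl ; (suc j) → u≗v j })
    ; 0∈       = ∈-resp-≗ (λ { zero → refl ; (suc j) → refl }) 0∈
    ; +-closed = λ Su Sv → ∈-resp-≗ (λ { zero → +-identityʳ 0# ; (suc j) → refl }) (+-closed Su Sv)
    ; *-closed = λ a Su → ∈-resp-≗ (λ { zero → zeroʳ a ; (suc j) → refl }) (*-closed a Su)
    }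
    where open IsLinearSubset S-lin

  -- translating by -x · e maps the fibre over x onto the fibre over 0
  card-fibres-translate : ∀ {m} {S : Vect (suc m) → Set} → IsLinearSubset S → (S? : ∀ v → Dec (S v)) →
    ∀ {e} → S e → e zero ≡ 1# → ∀ x → card (λ w → S? (x V.∷ w)) ≡ card (λ w → S? (0# V.∷ w))
  card-fibres-translate {S = S} S-lin S? {e} Se e₀≡1 x =
    trans (card-cong (λ w → S? (x V.∷ w)) (λ w → S? (0# V.∷ (w +ᵛ t))) to from)
          (card-translate (IsLinearSubset.∈-resp-≗ (tail-linear S-lin)) (λ w → S? (0# V.∷ w)) t)
    where
    open IsLinearSubset S-lin
    t : Vect _
    t j = - x * e (suc j)
    to : ∀ {w} → S (x V.∷ w) → S (0# V.∷ (w +ᵛ t))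
    to Sxw = ∈-resp-≗ (λ { zero → trans (cong (λ y → x + - x * y) e₀≡1) (trans (cong (x +_) (*-identityʳ _)) (-‿inverseʳ x))
                         ; (suc j) → refl })
                      (+-closed Sxw (*-closed (- x) Se))
    from : ∀ {w} → S (0# V.∷ (w +ᵛ t)) → S (x V.∷ w)
    from {w} S0wt = ∈-resp-≗ (λ { zero → trans (+-identityˡ _) (trans (cong (x *_) e₀≡1) (*-identityʳ x))
                                ; (suc j) → cancel (w j) (e (suc j)) })
                             (+-closed S0wt (*-closed x Se))
      where
      cancel : ∀ y z → y + - x * z + x * z ≡ y
      cancel y z = begin
        y + - x * z + x * z     ≡⟨ +-assoc y _ _ ⟩
        y + (- x * z + x * z)   ≡⟨ cong (y +_) (sym (distribʳ z (- x) x)) ⟩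
        y + (- x + x) * z       ≡⟨ cong (λ s → y + s * z) (-‿inverseˡ x) ⟩
        y + 0# * z              ≡⟨ cong (y +_) (zeroˡ z) ⟩
        y + 0#                  ≡⟨ +-identityʳ y ⟩
        y                       ∎

  -- Either S has an element with nonzero first coordinate, and then it consists of Q translates of its
  -- subspace {w ∣ 0 ∷ w ∈ S}, or S equals that subspace, which again contains a nonzero vector.
  Q∣card : ∀ {m} {S : Vect m → Set} → IsLinearSubset S → (S? : ∀ v → Dec (S v)) →
           ∀ {v} → S v → NonZero v → Q ∣ card S?
  Q∣card {zero}  _ _ _ v≢0 = contradiction (λ ()) v≢0
  Q∣card {suc m} {S} S-lin S? {v} Sv v≢0
    with Any.any? (λ c → S? (Vec.lookup c) Dec.×-dec Dec.¬? (Vec.lookup c zero ≟ 0#)) (vectors (suc m))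
  ... | yes ∃s = subst (Q ∣_) (sym card-S≡card-S₀*Q) (n∣m*n (card S₀?))
    where
    open IsLinearSubset S-lin
    S₀? = λ w → S? (0# V.∷ w)
    s = Vec.lookup (proj₁ (Any.satisfied ∃s))
    s₀≢0 = proj₂ (proj₂ (Any.satisfied ∃s))
    card-S≡card-S₀*Q : card S? ≡ card S₀? ℕ.* Q
    card-S≡card-S₀*Q = begin
      card S?                                       ≡⟨ card-fibres ∈-resp-≗ S? ⟩
      ∑[ x ∈ elems ] card (λ w → S? (x V.∷ w))      ≡⟨ ∑-cong elems (λ {x} _ → card-fibres-translate S-lin S?
                                                         (*-closed _ (proj₁ (proj₂ (Any.satisfied ∃s)))) (inv*x≡1 (s zero) s₀≢0) x) ⟩
      ∑[ _ ∈ elems ] card S₀?                       ≡⟨ ∑-const (card S₀?) elems ⟩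
      card S₀? ℕ.* length elems                     ≡⟨ cong (card S₀? ℕ.*_) size ⟩
      card S₀? ℕ.* Q                                ∎
  ... | no ∄s = subst (Q ∣_) (sym card-S≡card-S₀) (Q∣card (tail-linear S-lin) S₀? S₀-tail tail≢0)
    where
    open IsLinearSubset S-lin
    S₀? = λ w → S? (0# V.∷ w)
    head≡0 : ∀ {s} → S s → s zero ≡ 0#
    head≡0 {s} Ss = Dec.decidable-stable (s zero ≟ 0#) (λ s₀≢0 → ∄s (Any.map (λ { refl →
      ∈-resp-≗ (λ j → sym (Vec.lookup∘tabulate s j)) Ss , subst (_≢ 0#) (sym (Vec.lookup∘tabulate s zero)) s₀≢0 })
      (∈-vectors (Vec.tabulate s))))
    S₀-tail : S (0# V.∷ (v ∘ suc))
    S₀-tail = ∈-resp-≗ (λ { zero → head≡0 Sv ; (suc j) → refl }) Sv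
    tail≢0 : NonZero (v ∘ suc)
    tail≢0 tail≗0 = v≢0 (λ { zero → head≡0 Sv ; (suc j) → tail≗0 j })
    card-S≡card-S₀ : card S? ≡ card S₀?
    card-S≡card-S₀ = trans (card-fibres ∈-resp-≗ S?) (∑-single (λ x → card (λ w → S? (x V.∷ w))) unique (complete 0#)
      (λ x≢0 → ∑-zero (vectors m) (λ _ → 𝟙-no (S? _) (x≢0 ∘ head≡0))))

  _~?_ : ∀ {m} (u v : Vect m) → Dec (u ~ v)
  u ~? v = Dec.map′ (λ ∃k → let (k , _ , u≗kv) = find ∃k in k , u≗kv)
                    (λ (k , u≗kv) → Any.map (λ { refl → u≗kv }) (complete k))
                    (Any.any? (λ k → Dec.¬? (k ≟ 0#) Dec.×-dec Fin.all? (λ j → u j ≟ k * v j)) elems)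

  nonzero-scalars : ∑[ k ∈ elems ] 𝟙 (Dec.¬? (k ≟ 0#)) ℕ.+ 1 ≡ Q
  nonzero-scalars = begin
    ∑[ k ∈ elems ] 𝟙 (Dec.¬? (k ≟ 0#)) ℕ.+ 1                          ≡⟨ cong (∑[ k ∈ elems ] 𝟙 (Dec.¬? (k ≟ 0#)) ℕ.+_) (sym one-zero) ⟩
    ∑[ k ∈ elems ] 𝟙 (Dec.¬? (k ≟ 0#)) ℕ.+ ∑[ k ∈ elems ] 𝟙 (k ≟ 0#) ≡⟨ ℕ.+-comm _ (∑[ k ∈ elems ] 𝟙 (k ≟ 0#)) ⟩
    ∑[ k ∈ elems ] 𝟙 (k ≟ 0#) ℕ.+ ∑[ k ∈ elems ] 𝟙 (Dec.¬? (k ≟ 0#)) ≡⟨ ∑-𝟙+∑-𝟙¬ (_≟ 0#) elems ⟩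
    length elems                                                      ≡⟨ size ⟩
    Q                                                                 ∎
    where
    one-zero : ∑[ k ∈ elems ] 𝟙 (k ≟ 0#) ≡ 1
    one-zero = ∑-𝟙-exactly-one _≡_ (_≟ 0#) unique (λ a≡0 b≡0 → trans a≡0 (sym b≡0)) (Any.map sym (complete 0#))

  -- k ↦ k · v is a bijection from the nonzero scalars onto the vectors ~ v
  card-~ : ∀ {m} {v : Vect m} → NonZero v → card (_~? v) ≡ ∑[ k ∈ elems ] 𝟙 (Dec.¬? (k ≟ 0#))
  card-~ {m} {v} v≢0 = trans (∑-cong (vectors m) (λ {c} _ → per-vector c))
                            (trans (∑-swap _ (vectors m) elems) (∑-cong elems (λ {k} _ → per-scalar k)))
    where
    kv : K → Vec K m
    kv k = Vec.tabulate (λ j → k * v j)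
    multiple? : ∀ k c → Dec (k ≢ 0# × c ≡ kv k)
    multiple? k c = Dec.¬? (k ≟ 0#) Dec.×-dec Vec.≡-dec _≟_ c (kv k)
    j₀ = proj₁ (nonZero⇒∃≢0 v≢0)
    same-scalar : ∀ {c a b} → a ≢ 0# × c ≡ kv a → b ≢ 0# × c ≡ kv b → a ≡ b
    same-scalar {c} {a} {b} (_ , c≡av) (_ , c≡bv) = *-cancelʳ-≢0 (proj₂ (nonZero⇒∃≢0 v≢0)) (begin
      a * v j₀                  ≡⟨ sym (Vec.lookup∘tabulate _ j₀) ⟩
      Vec.lookup (kv a) j₀      ≡⟨ cong (λ d → Vec.lookup d j₀) (trans (sym c≡av) c≡bv) ⟩
      Vec.lookup (kv b) j₀      ≡⟨ Vec.lookup∘tabulate _ j₀ ⟩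
      b * v j₀                  ∎)
    per-vector : ∀ c → 𝟙 (Vec.lookup c ~? v) ≡ ∑[ k ∈ elems ] 𝟙 (multiple? k c)
    per-vector c with Vec.lookup c ~? v
    ... | yes (k , k≢0 , c≗kv) = sym (∑-𝟙-exactly-one _≡_ (λ k → multiple? k c) unique same-scalar
            (Any.map (λ { refl → k≢0 , lookup-injective (λ j → trans (c≗kv j) (sym (Vec.lookup∘tabulate _ j))) })
                     (complete k)))
    ... | no  c≁v = sym (∑-zero elems (λ {k} _ → 𝟙-no (multiple? k c) (λ (k≢0 , c≡kv) →
            c≁v (k , k≢0 , λ j → trans (cong (λ d → Vec.lookup d j) c≡kv) (Vec.lookup∘tabulate _ j)))))
    per-scalar : ∀ k → ∑[ c ∈ vectors m ] 𝟙 (multiple? k c) ≡ 𝟙 (Dec.¬? (k ≟ 0#))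
    per-scalar k = case k ≟ 0# of λ where
      (yes k≡0) → trans (∑-zero (vectors m) (λ {c} _ → 𝟙-no (multiple? k c) (λ (k≢0 , _) → k≢0 k≡0)))
                        (sym (𝟙-no (Dec.¬? (k ≟ 0#)) (λ k≢0 → k≢0 k≡0)))
      (no k≢0)  → trans (∑-𝟙-exactly-one _≡_ (multiple? k) (vectors-unique m)
                          (λ (_ , a≡kv) (_ , b≡kv) → trans a≡kv (sym b≡kv))
                          (Any.map (λ kv≡c → k≢0 , sym kv≡c) (∈-vectors (kv k))))
                        (sym (𝟙-yes (Dec.¬? (k ≟ 0#)) k≢0))

  card-zero-or-nonzero : ∀ {m} {S : Vect m → Set} → IsLinearSubset S → (S? : ∀ v → Dec (S v)) →
                         card S? ≡ 1 ℕ.+ card (λ v → nonZero? v Dec.×-dec S? v)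
  card-zero-or-nonzero {m} {S} S-lin S? = begin
    card S?                                                          ≡⟨ ∑-cong (vectors m) (λ {c} _ → split c) ⟩
    ∑[ c ∈ vectors m ] (𝟙 (zero? c) ℕ.+ 𝟙 (nonzero∈S? c))          ≡⟨ ∑-+ _ _ (vectors m) ⟩
    ∑[ c ∈ vectors m ] 𝟙 (zero? c) ℕ.+ card (λ v → nonZero? v Dec.×-dec S? v)
      ≡⟨ cong (ℕ._+ card (λ v → nonZero? v Dec.×-dec S? v)) one-zero-vector ⟩
    1 ℕ.+ card (λ v → nonZero? v Dec.×-dec S? v)                     ∎
    where
    open IsLinearSubset S-lin
    nonzero∈S? : ∀ c → Dec (NonZero (Vec.lookup c) × S (Vec.lookup c))
    nonzero∈S? c = nonZero? (Vec.lookup c) Dec.×-dec S? (Vec.lookup c)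
    zero? : ∀ c → Dec (∀ j → Vec.lookup c j ≡ 0#)
    zero? c = Fin.all? (λ j → Vec.lookup c j ≟ 0#)
    split : ∀ c → 𝟙 (S? (Vec.lookup c)) ≡ 𝟙 (zero? c) ℕ.+ 𝟙 (nonzero∈S? c)
    split c with zero? c
    ... | yes c≗0 = 𝟙-yes (S? (Vec.lookup c)) (∈-resp-≗ (λ j → sym (c≗0 j)) 0∈)
    ... | no  c≢0 = 𝟙-cong (S? (Vec.lookup c)) (Dec.¬? (no c≢0) Dec.×-dec S? (Vec.lookup c)) (c≢0 ,_) proj₂
    one-zero-vector : ∑[ c ∈ vectors m ] 𝟙 (zero? c) ≡ 1
    one-zero-vector = ∑-𝟙-exactly-one _≡_ zero? (vectors-unique m)
      (λ a≗0 b≗0 → lookup-injective (λ j → trans (a≗0 j) (sym (b≗0 j))))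
      (Any.map (λ { refl j → Vec.lookup-replicate j 0# }) (∈-vectors (Vec.replicate m 0#)))

  -- every nonzero vector of S is a multiple of exactly one point of L
  card-nonzero≡∑card-~ : ∀ {m} {S : Vect m → Set} {L} → IsLinearSubset S → (S? : ∀ v → Dec (S v)) →
    EnumeratesPoints S L → card (λ v → nonZero? v Dec.×-dec S? v) ≡ ∑[ v ∈ L ] card (_~? v)
  card-nonzero≡∑card-~ {m} {S} {L} S-lin S? (L≢0 , L⊆S , L-distinct , L-covers) =
    trans (∑-cong (vectors m) (λ {c} _ → on-one-point (Vec.lookup c))) (∑-swap (λ c v → 𝟙 (Vec.lookup c ~? v)) (vectors m) L)
    where
    on-one-point : ∀ u → 𝟙 (nonZero? u Dec.×-dec S? u) ≡ ∑[ v ∈ L ] 𝟙 (u ~? v)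
    on-one-point u with nonZero? u Dec.×-dec S? u
    ... | yes (u≢0 , Su) = sym (∑-𝟙-exactly-one _~_ (u ~?_) L-distinct (λ u~a u~b → ~-trans (~-sym u~a) u~b)
                                                 (L-covers u u≢0 Su))
    ... | no  ¬u≢0∧Su    = sym (∑-zero L (λ v∈L → 𝟙-no (u ~? _) (λ u~v →
                              ¬u≢0∧Su (~-nonZero (All.lookup L≢0 v∈L) u~v , IsLinearSubset.~-closed S-lin (All.lookup L⊆S v∈L) u~v))))

  points-count : ∀ {m} {S : Vect m → Set} {L} → IsLinearSubset S → (S? : ∀ v → Dec (S v)) →
                 EnumeratesPoints S L → card S? ℕ.+ length L ≡ 1 ℕ.+ Q ℕ.* length L
  points-count {m} {L = L} S-lin S? L-enumerates@(L≢0 , _) = begin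
    card S? ℕ.+ length L                                       ≡⟨ cong₂ ℕ._+_ (card-zero-or-nonzero S-lin S?) (sym (∑-const′ L)) ⟩
    1 ℕ.+ card (λ v → nonZero? v Dec.×-dec S? v) ℕ.+ ∑[ _ ∈ L ] 1
      ≡⟨ cong (λ n → 1 ℕ.+ n ℕ.+ ∑[ _ ∈ L ] 1) (card-nonzero≡∑card-~ S-lin S? L-enumerates) ⟩
    1 ℕ.+ ∑[ v ∈ L ] card (_~? v) ℕ.+ ∑[ _ ∈ L ] 1           ≡⟨ ℕ.+-assoc 1 (∑[ v ∈ L ] card (_~? v)) _ ⟩
    1 ℕ.+ (∑[ v ∈ L ] card (_~? v) ℕ.+ ∑[ _ ∈ L ] 1)         ≡⟨ cong (1 ℕ.+_) (sym (∑-+ (λ v → card (_~? v)) (λ _ → 1) L)) ⟩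
    1 ℕ.+ ∑[ v ∈ L ] (card (_~? v) ℕ.+ 1)                    ≡⟨ cong (1 ℕ.+_) (∑-cong L (λ v∈L → multiples v∈L)) ⟩
    1 ℕ.+ ∑[ _ ∈ L ] Q                                        ≡⟨ cong (1 ℕ.+_) (∑-const Q L) ⟩
    1 ℕ.+ Q ℕ.* length L                                      ∎
    where
    ∑-const′ : ∀ (xs : List (Vect m)) → ∑[ _ ∈ xs ] 1 ≡ length xs
    ∑-const′ xs = trans (∑-const 1 xs) (ℕ.*-identityˡ _)
    multiples : ∀ {v} → v ∈ L → card (_~? v) ℕ.+ 1 ≡ Q
    multiples v∈L = trans (cong (ℕ._+ 1) (card-~ (All.lookup L≢0 v∈L))) nonzero-scalars

  -- Every x would be a root of the monic polynomial xᵐ - x of degree m < Q.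
  pow-not-identity : ∀ {m} → 1 < m → m < Q → ∃[ x ] pow x m ≢ x
  pow-not-identity {suc zero}    (s≤s ()) _
  pow-not-identity {suc (suc k)} _ m<Q with Any.any? (λ x → Dec.¬? (pow x (suc (suc k)) ≟ x)) elems
  ... | yes ∃x = Any.satisfied ∃x
  ... | no  ∄x = contradiction (subst (_≤ suc (suc k)) size (ℕ.≤-trans (roots≤degree xᵐ-x unique (All.tabulate (λ {x} _ → root x)))
                                                                    (ℕ.≤-reflexive degree)))
                               (ℕ.<⇒≱ m<Q)
    where
    open MonicPolynomial F
    xᵐ-x : List K
    xᵐ-x = 0# ∷ - 1# ∷ List.replicate k 0#
    degree : length xᵐ-x ≡ suc (suc k)
    degree = cong (λ l → suc (suc l)) (List.length-replicate k {0#})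
    eval-xᵏ : ∀ k x → eval (List.replicate k 0#) x ≡ pow x k
    eval-xᵏ zero    x = refl
    eval-xᵏ (suc k) x = trans (+-identityˡ _) (cong (x *_) (eval-xᵏ k x))
    fixed : ∀ x → pow x (suc (suc k)) ≡ x
    fixed x = Dec.decidable-stable (pow x (suc (suc k)) ≟ x) (All.lookup (All.¬Any⇒All¬ elems ∄x) (complete x))
    root : ∀ x → eval xᵐ-x x ≡ 0#
    root x = begin
      0# + x * (- 1# + x * eval (List.replicate k 0#) x) ≡⟨ +-identityˡ _ ⟩
      x * (- 1# + x * eval (List.replicate k 0#) x)      ≡⟨ cong (λ t → x * (- 1# + x * t)) (eval-xᵏ k x) ⟩
      x * (- 1# + x * pow x k)                           ≡⟨ distribˡ x (- 1#) _ ⟩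
      x * - 1# + pow x (suc (suc k))                     ≡⟨ cong (x * - 1# +_) (fixed x) ⟩
      x * - 1# + x                                       ≡⟨ cong (_+ x) (trans (*-comm x (- 1#)) (-1*x≈-x x)) ⟩
      - x + x                                            ≡⟨ -‿inverseˡ x ⟩
      0#                                                 ∎

  span? : ∀ {k m} (b : Fin k → Vect m) v → Dec (InSpan b v)
  span? {k} b v = Dec.map′ (λ ∃c → let (c , _ , v≗cb) = find ∃c in Vec.lookup c , v≗cb)
    (λ (c , v≗cb) → Any.map (λ { refl j → trans (v≗cb j) (comb-cong b (λ i → sym (Vec.lookup∘tabulate c i)) j) })
                            (∈-vectors (Vec.tabulate c)))
    (Any.any? (λ c → Fin.all? (λ j → v j ≟ comb (Vec.lookup c) b j)) (vectors k))

  enumerates-∩ : ∀ {m} {S T : Vect m → Set} {L} (T? : ∀ v → Dec (T v)) → IsLinearSubset T →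
                 EnumeratesPoints S L → EnumeratesPoints (λ v → S v × T v) (List.filter T? L)
  enumerates-∩ {S = S} {T} {L} T? T-lin (L≢0 , L⊆S , L-distinct , L-covers) =
    All.filter⁺ T? L≢0 ,
    All.zip (All.filter⁺ T? L⊆S , All.all-filter T? L) ,
    AllPairs.filter⁺ T? L-distinct ,
    covers
    where
    covers : ∀ v → NonZero v → S v × T v → Any (v ~_) (List.filter T? L)
    covers v v≢0 (Sv , Tv) with Any.filter⁺ T? (L-covers v v≢0 Sv)
    ... | inj₁ covered = covered
    ... | inj₂ ¬Tw = contradiction (IsLinearSubset.~-closed T-lin Tv (~-sym (Any.lookup-result (L-covers v v≢0 Sv)))) ¬Tw

[k+1]*[n+1]C[k+1]≡[n+1]*nCk : ∀ n k → suc k ℕ.* (suc n C suc k) ≡ suc n ℕ.* (n C k)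
[k+1]*[n+1]C[k+1]≡[n+1]*nCk zero    zero    = refl
[k+1]*[n+1]C[k+1]≡[n+1]*nCk zero    (suc k) = ℕ.*-zeroʳ (suc (suc k))
[k+1]*[n+1]C[k+1]≡[n+1]*nCk (suc n) zero    =
  trans (ℕ.*-identityˡ _) (trans (nC1≡n (suc (suc n))) (sym (ℕ.*-identityʳ _)))
[k+1]*[n+1]C[k+1]≡[n+1]*nCk (suc n) (suc k) = begin
  suc (suc k) ℕ.* (suc (suc n) C suc (suc k))
    ≡⟨ cong (suc (suc k) ℕ.*_) (sym (nCk+nC[k+1]≡[n+1]C[k+1] (suc n) (suc k))) ⟩
  suc (suc k) ℕ.* (suc n C suc k ℕ.+ suc n C suc (suc k))
    ≡⟨ ℕ.*-distribˡ-+ (suc (suc k)) (suc n C suc k) (suc n C suc (suc k)) ⟩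
  (suc n C suc k ℕ.+ suc k ℕ.* (suc n C suc k)) ℕ.+ suc (suc k) ℕ.* (suc n C suc (suc k))
    ≡⟨ cong₂ (λ a b → (suc n C suc k ℕ.+ a) ℕ.+ b)
             ([k+1]*[n+1]C[k+1]≡[n+1]*nCk n k) ([k+1]*[n+1]C[k+1]≡[n+1]*nCk n (suc k)) ⟩
  (suc n C suc k ℕ.+ suc n ℕ.* (n C k)) ℕ.+ suc n ℕ.* (n C suc k)
    ≡⟨ ℕ.+-assoc (suc n C suc k) _ _ ⟩
  suc n C suc k ℕ.+ (suc n ℕ.* (n C k) ℕ.+ suc n ℕ.* (n C suc k))
    ≡⟨ cong (suc n C suc k ℕ.+_) (sym (ℕ.*-distribˡ-+ (suc n) (n C k) (n C suc k))) ⟩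
  suc n C suc k ℕ.+ suc n ℕ.* (n C k ℕ.+ n C suc k)
    ≡⟨ cong (λ c → suc n C suc k ℕ.+ suc n ℕ.* c) (nCk+nC[k+1]≡[n+1]C[k+1] n k) ⟩
  suc (suc n) ℕ.* (suc n C suc k) ∎
  where open ≡-Reasoning

prime∣pCk : ∀ {p} → Prime p → ∀ {k} → 0 < k → k < p → p ∣ p C k
prime∣pCk {suc p′} p-prime {suc k} _ k<p
  with euclidsLemma (suc k) (suc p′ C suc k) p-prime
         (divides (p′ C k) (trans ([k+1]*[n+1]C[k+1]≡[n+1]*nCk p′ k) (ℕ.*-comm (suc p′) _)))
... | inj₁ p∣k+1 = contradiction (∣⇒≤ p∣k+1) (ℕ.<⇒≱ k<p)
... | inj₂ p∣pCk = p∣pCk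

module Hermitian (F : Field) (p h : ℕ) (p-prime : Prime p) (h≥1 : 1 ≤ h) (ord : HasOrder F ((p ^ h) ^ 2)) where

  q : ℕ
  q = p ^ h

  open FieldProperties F
  open HasOrder ord
  open Geometry F q
  open Vectors F q
  open FiniteField F (q ^ 2) ord q public
  open Counting
  open ≡-Reasoning

  pow≡0⇒≡0 : ∀ {x} k → pow x k ≡ 0# → x ≡ 0#
  pow≡0⇒≡0 {x} k xᵏ≡0 = Dec.decidable-stable (x ≟ 0#) (λ x≢0 → pow-≢0 k x≢0 xᵏ≡0)

  fromℕ-^ : ∀ a b → fromℕ (a ^ b) ≡ pow (fromℕ a) b
  fromℕ-^ a zero    = +-identityʳ 1#
  fromℕ-^ a (suc b) = trans (fromℕ-* a (a ^ b)) (cong (fromℕ a *_) (fromℕ-^ a b))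

  fromℕ-p≡0 : fromℕ p ≡ 0#
  fromℕ-p≡0 = pow≡0⇒≡0 h (trans (sym (fromℕ-^ p h)) (pow≡0⇒≡0 2 (trans (sym (fromℕ-^ q 2)) fromℕ-order≡0)))

  pow-p-+ : ∀ x y → pow (x + y) p ≡ pow x p + pow y p
  pow-p-+ = freshman's-dream (ℕ.nonTrivial⇒n>1 p {{prime⇒nonTrivial p-prime}}) pCk≡0
    where
    pCk≡0 : ∀ {k} → 0 < k → k < p → fromℕ (p C k) ≡ 0#
    pCk≡0 0<k k<p with prime∣pCk p-prime 0<k k<p
    ... | divides c pCk≡c*p = trans (cong fromℕ pCk≡c*p) (trans (fromℕ-* c p) (trans (cong (fromℕ c *_) fromℕ-p≡0) (zeroʳ _)))

  pow-pᵉ-+ : ∀ e x y → pow (x + y) (p ^ e) ≡ pow x (p ^ e) + pow y (p ^ e)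
  pow-pᵉ-+ zero    x y = trans (*-identityʳ _) (sym (cong₂ _+_ (*-identityʳ x) (*-identityʳ y)))
  pow-pᵉ-+ (suc e) x y = begin
    pow (x + y) (p ℕ.* p ^ e)                      ≡⟨ pow-pow (x + y) p (p ^ e) ⟩
    pow (pow (x + y) p) (p ^ e)                    ≡⟨ cong (λ z → pow z (p ^ e)) (pow-p-+ x y) ⟩
    pow (pow x p + pow y p) (p ^ e)                ≡⟨ pow-pᵉ-+ e (pow x p) (pow y p) ⟩
    pow (pow x p) (p ^ e) + pow (pow y p) (p ^ e)  ≡⟨ sym (cong₂ _+_ (pow-pow x p (p ^ e)) (pow-pow y p (p ^ e))) ⟩
    pow x (p ℕ.* p ^ e) + pow y (p ℕ.* p ^ e)      ∎

  conj-+ : ∀ x y → conj (x + y) ≡ conj x + conj y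
  conj-+ = pow-pᵉ-+ h

  conj-* : ∀ x y → conj (x * y) ≡ conj x * conj y
  conj-* x y = pow-* x y q

  conj-0# : conj 0# ≡ 0#
  conj-0# = pow-0# q (ℕ.m^n>0 p {{prime⇒nonZero p-prime}} h)

  conj-1# : conj 1# ≡ 1#
  conj-1# = pow-1# q

  conj-injective : ∀ {x y} → conj x ≡ conj y → x ≡ y
  conj-injective {x} {y} conjx≡conjy = x∙y⁻¹≈ε⇒x≈y x y (pow≡0⇒≡0 q (begin
    conj (x - y)        ≡⟨ conj-+ x (- y) ⟩
    conj x + conj (- y) ≡⟨ cong (conj x +_) conj-neg ⟩
    conj x - conj y     ≡⟨ x≈y⇒x∙y⁻¹≈ε conjx≡conjy ⟩
    0#                  ∎))
    where
    conj-neg : conj (- y) ≡ - conj y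
    conj-neg = +-inverseʳ-unique (conj y) (conj (- y)) (trans (sym (conj-+ y (- y))) (trans (cong conj (-‿inverseʳ y)) conj-0#))

  -- otherwise y followed by the images of all Q elements would be Q + 1 distinct elements
  conj-surjective : ∀ y → ∃[ x ] conj x ≡ y
  conj-surjective y with Any.any? (λ x → conj x ≟ y) elems
  ... | yes ∃x = Any.satisfied ∃x
  ... | no  ∄x = contradiction (Unique⇒length≤ (y∉image ∷ Unique.map⁺ conj-injective unique) (λ _ → complete _))
                               (ℕ.<-irrefl refl ∘ subst (λ l → suc l ≤ length elems) (List.length-map conj elems))
    where
    y∉image : All (y ≢_) (map conj elems)
    y∉image = All.map⁺ (All.map (λ conjx≢y y≡conjx → conjx≢y (sym y≡conjx)) (All.¬Any⇒All¬ elems ∄x))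

  1<q : 1 < q
  1<q = ℕ.<-≤-trans (ℕ.nonTrivial⇒n>1 p {{prime⇒nonTrivial p-prime}})
          (subst (_≤ q) (ℕ.*-identityʳ p) (ℕ.^-monoʳ-≤ p {{prime⇒nonZero p-prime}} h≥1))

  conj-not-identity : ∃[ x ] conj x ≢ x
  conj-not-identity = pow-not-identity 1<q (subst (_< q ^ 2) (ℕ.*-identityʳ q) (ℕ.^-monoʳ-< q 1<q {1} {2} (s≤s (s≤s z≤n))))

  conj-sumFin : ∀ {n} (f : Fin n → K) → conj (sumFin f) ≡ sumFin (conj ∘ f)
  conj-sumFin {zero}  f = conj-0#
  conj-sumFin {suc n} f = trans (conj-+ _ _) (cong (conj (f zero) +_) (conj-sumFin (f ∘ suc)))

  herm-+ʳ : ∀ {m} (u v w : Vect m) → herm u (v +ᵛ w) ≡ herm u v + herm u w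
  herm-+ʳ u v w = trans (sumFin-cong (λ j → trans (cong (u j *_) (conj-+ (v j) (w j))) (distribˡ (u j) _ _)))
                        (sumFin-+ (λ j → u j * conj (v j)) (λ j → u j * conj (w j)))

  herm-zeroʳ : ∀ {m} (u : Vect m) {w} → (∀ j → w j ≡ 0#) → herm u w ≡ 0#
  herm-zeroʳ u w≗0 = sumFin-zero (λ j → trans (cong (λ x → u j * conj x) (w≗0 j)) (trans (cong (u j *_) conj-0#) (zeroʳ _)))

  herm-combʳ : ∀ {k m} (u : Vect m) (c : Fin k → K) (b : Fin k → Vect m) →
               herm u (comb c b) ≡ sumFin (λ i → conj (c i) * herm u (b i))
  herm-combʳ u c b = begin
    sumFin (λ j → u j * conj (comb c b j))
      ≡⟨ sumFin-cong (λ j → trans (cong (u j *_) (trans (conj-sumFin (λ i → c i * b i j)) (sumFin-cong (λ i → conj-* (c i) (b i j)))))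
                                  (sumFin-*ˡ (u j) (λ i → conj (c i) * conj (b i j)))) ⟩
    sumFin (λ j → sumFin (λ i → u j * (conj (c i) * conj (b i j))))
      ≡⟨ sumFin-swap (λ j i → u j * (conj (c i) * conj (b i j))) ⟩
    sumFin (λ i → sumFin (λ j → u j * (conj (c i) * conj (b i j))))
      ≡⟨ sumFin-cong (λ i → trans (sumFin-cong (λ j → *-exchange (u j) (conj (c i)) _))
                                  (sym (sumFin-*ˡ (conj (c i)) (λ j → u j * conj (b i j))))) ⟩
    sumFin (λ i → conj (c i) * herm u (b i)) ∎

  polar-linear : ∀ {d m} (π : Subspace d m) → IsLinearSubset (polar π)
  polar-linear π = record
    { ∈-resp-≗ = λ w≗w′ π⊥w u π∋u → trans (herm-congʳ u (sym ∘ w≗w′)) (π⊥w u π∋u)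
    ; 0∈       = λ u _ → herm-zeroʳ u (λ _ → refl)
    ; +-closed = λ π⊥v π⊥w u π∋u → trans (herm-+ʳ u _ _) (trans (cong₂ _+_ (π⊥v u π∋u) (π⊥w u π∋u)) (+-identityʳ 0#))
    ; *-closed = λ a π⊥w u π∋u → trans (herm-*ʳ a u _) (trans (cong (conj a *_) (π⊥w u π∋u)) (zeroʳ _))
    }

  polar? : ∀ {d m} (π : Subspace d m) w → Dec (polar π w)
  polar? π w = Dec.map′ (λ basis⊥w _ → ⊥-basis⇒⊥-span (Subspace.basis π) basis⊥w)
                        (λ π⊥w i → π⊥w _ (basis∈span (Subspace.basis π) i))
                        (Fin.all? (λ i → herm (Subspace.basis π i) w ≟ 0#))

  OnH-~ : ∀ {m} {u v : Vect m} → OnH v → u ~ v → OnH u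
  OnH-~ {u = u} {v} Hv (k , _ , u≗kv) = begin
    herm u u                  ≡⟨ herm-congˡ u u≗kv ⟩
    herm (k ·ᵛ v) u           ≡⟨ herm-*ˡ k v u ⟩
    k * herm v u              ≡⟨ cong (k *_) (trans (herm-congʳ v u≗kv) (herm-*ʳ k v v)) ⟩
    k * (conj k * herm v v)   ≡⟨ cong (λ t → k * (conj k * t)) Hv ⟩
    k * (conj k * 0#)         ≡⟨ trans (cong (k *_) (zeroʳ _)) (zeroʳ k) ⟩
    0#                        ∎

  -- From isotropy of u + l·w for all l one gets conj l · h(u,w) + l · h(w,u) = 0; take l = 1 and l with conj l ≠ l.
  totally-isotropic : ∀ {k m} (b : Fin k → Vect m) → (∀ {v} → InSpan b v → OnH v) →
                      ∀ {u w} → InSpan b u → InSpan b w → herm u w ≡ 0#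
  totally-isotropic b isotropic {u} {w} Su Sw = x*z≡y*z⇒z≡0 (proj₂ conj-not-identity) (+-cancelʳ _ _ _ (begin
    conj l₀ * a + l₀ * a′  ≡⟨ cross-terms l₀ ⟩
    0#                     ≡⟨ sym (zeroʳ l₀) ⟩
    l₀ * 0#                ≡⟨ cong (l₀ *_) (sym a+a′≡0) ⟩
    l₀ * (a + a′)          ≡⟨ distribˡ l₀ a a′ ⟩
    l₀ * a + l₀ * a′       ∎))
    where
    open IsLinearSubset (span-linear b)
    a = herm u w
    a′ = herm w u
    l₀ = proj₁ conj-not-identity
    cross-terms : ∀ l → conj l * a + l * a′ ≡ 0#
    cross-terms l = begin
      conj l * a + l * a′                                ≡⟨ sym (cong₂ _+_ (herm-*ʳ l u w) (herm-*ˡ l w u)) ⟩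
      herm u lw + herm lw u                              ≡⟨ cong₂ _+_ (sym (+-identityˡ _)) (sym (+-identityʳ _)) ⟩
      (0# + herm u lw) + (herm lw u + 0#)                ≡⟨ cong₂ (λ s t → (s + herm u lw) + (herm lw u + t))
                                                                 (sym (isotropic Su)) (sym (isotropic Slw)) ⟩
      (herm u u + herm u lw) + (herm lw u + herm lw lw)  ≡⟨ sym (cong₂ _+_ (herm-+ʳ u u lw) (herm-+ʳ lw u lw)) ⟩
      herm u (u +ᵛ lw) + herm lw (u +ᵛ lw)               ≡⟨ sym (herm-+ˡ u lw (u +ᵛ lw)) ⟩
      herm (u +ᵛ lw) (u +ᵛ lw)                           ≡⟨ isotropic (+-closed Su Slw) ⟩
      0#                                                 ∎
      where
      lw = l ·ᵛ w
      Slw = *-closed l Sw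
    a+a′≡0 : a + a′ ≡ 0#
    a+a′≡0 = trans (cong₂ _+_ (sym (trans (cong (_* a) conj-1#) (*-identityˡ a))) (sym (*-identityˡ a′))) (cross-terms 1#)

  -- Adjoin a unit vector eⱼ with h(eⱼ, w) = conj wⱼ ≠ 0 to get k + 1 ≥ m + 1 vectors of K^m; pairing a
  -- dependence among them with w shows that eⱼ does not occur in it.
  ⊥-nonzero⇒dependent : ∀ {m k} → m ≤ k → ∀ {w : Vect m} → NonZero w → (vs : Fin k → Vect m) → (∀ t → herm (vs t) w ≡ 0#) →
    ∃ λ (y : Fin k → K) → (∃[ t ] y t ≢ 0#) × (∀ r → comb y vs r ≡ 0#)
  ⊥-nonzero⇒dependent {zero}      _   w≢0 _  _    = contradiction (λ ()) w≢0
  ⊥-nonzero⇒dependent {m@(suc _)} {k} m≤k {w} w≢0 vs vs⊥w = y ∘ suc , y-nontrivial , dependence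
    where
    j₀ = proj₁ (nonZero⇒∃≢0 w≢0)
    vs′ : Fin (suc k) → Vect m
    vs′ = unitVec j₀ V.∷ vs
    solution = homogeneous-solution m k m≤k (λ r t → vs′ t r)
    y = proj₁ solution
    dependence′ : ∀ r → comb y vs′ r ≡ 0#
    dependence′ r = trans (sumFin-cong (λ t → *-comm (y t) (vs′ t r))) (proj₂ (proj₂ solution) r)
    y₀≡0 : y zero ≡ 0#
    y₀≡0 = x*y≡0⇒y≡0 (proj₂ (nonZero⇒∃≢0 w≢0) ∘ pow≡0⇒≡0 q) (begin
      conj (w j₀) * y zero                                    ≡⟨ *-comm _ (y zero) ⟩
      y zero * conj (w j₀)                                    ≡⟨ cong (y zero *_) (sym (herm-unitVecˡ j₀ w)) ⟩
      y zero * herm (unitVec j₀) w                            ≡⟨ sym (+-identityʳ _) ⟩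
      y zero * herm (unitVec j₀) w + 0#                       ≡⟨ cong (y zero * herm (unitVec j₀) w +_)
                                                                   (sym (sumFin-zero (λ t → trans (cong (y (suc t) *_) (vs⊥w t)) (zeroʳ _)))) ⟩
      sumFin (λ t → y t * herm (vs′ t) w)                     ≡⟨ sym (herm-combˡ y vs′ w) ⟩
      herm (comb y vs′) w                                     ≡⟨ herm-zeroˡ w dependence′ ⟩
      0#                                                      ∎)
    dependence : ∀ r → comb (y ∘ suc) vs r ≡ 0#
    dependence r = trans (sym (+-identityˡ _)) (trans (cong (_+ comb (y ∘ suc) vs r) (sym (trans (cong (_* unitVec j₀ r) y₀≡0) (zeroˡ _))))
                                                      (dependence′ r))
    y-nontrivial : ∃[ t ] y (suc t) ≢ 0#
    y-nontrivial with proj₁ (proj₂ solution)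
    ... | zero  , y₀≢0 = contradiction y₀≡0 y₀≢0
    ... | suc t , yₜ≢0 = t , yₜ≢0

  Meets : ∀ {n} → Generator n → (Vect (suc (suc (n ℕ.+ n))) → Set) → Set
  Meets μ S = ∃[ v ] NonZero v × Generator.space μ ∋ₚ v × S v

  generator-isotropic : ∀ {n} (μ : Generator n) {u w} → Generator.space μ ∋ₚ u → Generator.space μ ∋ₚ w → herm u w ≡ 0#
  generator-isotropic μ = totally-isotropic (Subspace.basis (Generator.space μ)) (Generator.contained μ _)

  -- If u ≠ 0 lies in μ ∩ π, the conditions h(π, w) = 0 on w ∈ μ are linearly dependent (u ∈ π is orthogonal to μ).
  meets⇒meets-polar : ∀ {n} (μ : Generator n) (π : Subspace n (suc (suc (n ℕ.+ n)))) → Meets μ (π ∋ₚ_) → Meets μ (polar π)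
  meets⇒meets-polar {n} μ π (u , u≢0 , μ∋u , c , u≗cP) = w , w≢0 , (d , λ _ → refl) , π⊥w
    where
    M = Subspace.basis (Generator.space μ)
    P = Subspace.basis π
    A : Fin (suc n) → Fin (suc n) → K
    A i j = herm (P i) (M j)
    c≢0 : ∃[ k ] c k ≢ 0#
    c≢0 = nonZero⇒∃≢0 (λ c≗0 → u≢0 (λ j → trans (u≗cP j) (trans (comb-cong P c≗0 j) (comb-zero P j))))
    k₀ = proj₁ c≢0
    c·A≡0 : ∀ j → sumFin (λ i → c i * A i j) ≡ 0#
    c·A≡0 j = trans (sym (herm-combˡ c P (M j)))
                    (trans (herm-congˡ (M j) (sym ∘ u≗cP)) (generator-isotropic μ μ∋u (basis∈span M j)))
    solution = homogeneous-solution n n ℕ.≤-refl (λ i j → A (punchIn k₀ i) j)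
    e = proj₁ solution
    R : Fin (suc n) → K
    R i = sumFin (λ j → A i j * e j)
    c·R≡0 : sumFin (λ i → c i * R i) ≡ 0#
    c·R≡0 = trans (sumFin-bilinear c A e) (sumFin-zero (λ j → trans (cong (_* e j) (c·A≡0 j)) (zeroˡ (e j))))
    R≡0 : ∀ i → R i ≡ 0#
    R≡0 = punchIn-cases (λ i → R i ≡ 0#) k₀ (x*y≡0⇒y≡0 (proj₂ c≢0) (begin
      c k₀ * R k₀                                             ≡⟨ sym (+-identityʳ _) ⟩
      c k₀ * R k₀ + 0#                                        ≡⟨ cong (c k₀ * R k₀ +_) (sym (sumFin-zero (λ i →
                                                                   trans (cong (c (punchIn k₀ i) *_) (proj₂ (proj₂ solution) i)) (zeroʳ _)))) ⟩
      c k₀ * R k₀ + sumFin (λ i → c (punchIn k₀ i) * R (punchIn k₀ i)) ≡⟨ sym (sumFin-punchIn (λ i → c i * R i) k₀) ⟩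
      sumFin (λ i → c i * R i)                                ≡⟨ c·R≡0 ⟩
      0#                                                      ∎)) (proj₂ (proj₂ solution))
    d : Fin (suc n) → K
    d j = proj₁ (conj-surjective (e j))
    w : Vect (suc (suc (n ℕ.+ n)))
    w = comb d M
    Pᵢ⊥w : ∀ i → herm (P i) w ≡ 0#
    Pᵢ⊥w i = trans (herm-combʳ (P i) d M)
                   (trans (sumFin-cong (λ j → trans (cong (_* A i j) (proj₂ (conj-surjective (e j)))) (*-comm (e j) (A i j))))
                          (R≡0 i))
    π⊥w : polar π w
    π⊥w _ π∋u′ = ⊥-basis⇒⊥-span P {w = w} Pᵢ⊥w π∋u′
    w≢0 : NonZero w
    w≢0 w≗0 = proj₂ (proj₁ (proj₂ solution)) (begin
      e j₁               ≡⟨ sym (proj₂ (conj-surjective (e j₁))) ⟩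
      conj (d j₁)        ≡⟨ cong conj (Subspace.indep (Generator.space μ) d w≗0 j₁) ⟩
      conj 0#            ≡⟨ conj-0# ⟩
      0#                 ∎)
      where j₁ = proj₁ (proj₁ (proj₂ solution))

  -- μ + π lies in the hyperplane w^⊥, so the 2n + 2 basis vectors of μ and π are dependent.
  meets-polar⇒meets : ∀ {n} (μ : Generator n) (π : Subspace n (suc (suc (n ℕ.+ n)))) → Meets μ (polar π) → Meets μ (π ∋ₚ_)
  meets-polar⇒meets {n} μ π (w , w≢0 , μ∋w , π⊥w) = u , u≢0 , (cM , λ _ → refl) , (λ i → - cP i) , u∈π
    where
    M = Subspace.basis (Generator.space μ)
    P = Subspace.basis π
    M++P⊥w : ∀ t → herm ((M V.++ P) t) w ≡ 0#
    M++P⊥w = ↑-cases (λ t → herm ((M V.++ P) t) w ≡ 0#)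
      (λ i → trans (cong (λ v → herm v w) (V.lookup-++ˡ M P i)) (generator-isotropic μ (basis∈span M i) μ∋w))
      (λ i → trans (cong (λ v → herm v w) (V.lookup-++ʳ M P i)) (π⊥w (P i) (basis∈span P i)))
    dependence = ⊥-nonzero⇒dependent (ℕ.≤-reflexive (cong suc (sym (ℕ.+-suc n n)))) w≢0 (M V.++ P) M++P⊥w
    y = proj₁ dependence
    cM cP : Fin (suc n) → K
    cM i = y (i ↑ˡ suc n)
    cP i = y (suc n ↑ʳ i)
    u : Vect (suc (suc (n ℕ.+ n)))
    u = comb cM M
    u+cP·P≡0 : ∀ r → u r + comb cP P r ≡ 0#
    u+cP·P≡0 r = trans (sym (comb-++ y M P r)) (proj₂ (proj₂ dependence) r)
    u∈π : ∀ r → u r ≡ comb (λ i → - cP i) P r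
    u∈π r = trans (+-inverseˡ-unique _ _ (u+cP·P≡0 r)) (sym (comb-neg cP P r))
    u≢0 : NonZero u
    u≢0 u≗0 = proj₂ (proj₁ (proj₂ dependence)) (↑-cases (λ t → y t ≡ 0#) cM≡0 cP≡0 _)
      where
      cM≡0 : ∀ i → cM i ≡ 0#
      cM≡0 = Subspace.indep (Generator.space μ) cM u≗0
      cP≡0 : ∀ i → cP i ≡ 0#
      cP≡0 = Subspace.indep π cP (λ r → trans (sym (+-identityˡ _)) (trans (cong (_+ comb cP P r) (sym (u≗0 r))) (u+cP·P≡0 r)))

  p∣q² : p ∣ q ^ 2
  p∣q² = ∣-trans (p∣pᵉ h h≥1) (m∣m*n (q ^ 1))
    where
    p∣pᵉ : ∀ e → 1 ≤ e → p ∣ p ^ e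
    p∣pᵉ (suc e) _ = m∣m*n (p ^ e)

  -- N is the number of vectors in S ∩ T
  points-count-∩ : ∀ {m} {S T : Vect m → Set} {L} → IsLinearSubset S → (S? : ∀ v → Dec (S v)) →
    IsLinearSubset T → (T? : ∀ v → Dec (T v)) → EnumeratesPoints S L → Any T L →
    ∃[ N ] p ∣ N × N ℕ.+ ∑[ v ∈ L ] 𝟙 (T? v) ≡ 1 ℕ.+ q ^ 2 ℕ.* ∑[ v ∈ L ] 𝟙 (T? v)
  points-count-∩ {L = L} S-lin S? T-lin T? L-enumerates ∃v =
    card S∩T? , ∣-trans p∣q² (Q∣card S∩T-lin S∩T? STv v≢0) ,
    subst (λ t → card S∩T? ℕ.+ t ≡ 1 ℕ.+ q ^ 2 ℕ.* t) (length-filter≡∑𝟙 T? L)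
          (points-count S∩T-lin S∩T? (enumerates-∩ T? T-lin L-enumerates))
    where
    S∩T-lin = ∩-linear S-lin T-lin
    S∩T? = λ v → S? v Dec.×-dec T? v
    v = proj₁ (Any⇒nonzero-∩ L-enumerates ∃v)
    v≢0 = proj₁ (proj₂ (Any⇒nonzero-∩ L-enumerates ∃v))
    STv = proj₂ (proj₂ (Any⇒nonzero-∩ L-enumerates ∃v))

  Any-span⇒Any-polar : ∀ {n} (μ : Generator n) π {L} → EnumeratesPoints (Generator.space μ ∋ₚ_) L →
                       Any (π ∋ₚ_) L → Any (polar π) L
  Any-span⇒Any-polar μ π L-enumerates =
    nonzero-∩⇒Any L-enumerates (IsLinearSubset.~-closed (polar-linear π)) ∘ meets⇒meets-polar μ π ∘ Any⇒nonzero-∩ L-enumerates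

  Any-polar⇒Any-span : ∀ {n} (μ : Generator n) π {L} → EnumeratesPoints (Generator.space μ ∋ₚ_) L →
                       Any (polar π) L → Any (π ∋ₚ_) L
  Any-polar⇒Any-span μ π L-enumerates =
    nonzero-∩⇒Any L-enumerates (IsLinearSubset.~-closed (span-linear (Subspace.basis π))) ∘ meets-polar⇒meets μ π ∘
    Any⇒nonzero-∩ L-enumerates

module Congruence where

  open import Data.Integer using (+_; _*_; _-_)
  open ≡-Reasoning

  difference-of-shifts : ∀ x y o → (x - o) - (y - o) ≡ x - y
  difference-of-shifts = ℤ-solve-∀

  ≡1-mod : ∀ {p N t Q} → N ℕ.+ t ≡ 1 ℕ.+ Q ℕ.* t → p ∣ N → p ∣ Q → + p Signed.∣ + t - + 1
  ≡1-mod {p} {N} {t} {Q} N+t≡1+Qt p∣N p∣Q = subst (+ p Signed.∣_) (sym t-1≡Qt-N)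
    (Signed.∣m∣n⇒∣m-n (Signed.∣m⇒∣m*n (+ t) (Signed.∣ᵤ⇒∣ {i = + Q} p∣Q)) (Signed.∣ᵤ⇒∣ {i = + N} p∣N))
    where
    t-1≡Qt-N : + t - + 1 ≡ + Q * + t - + N
    t-1≡Qt-N = begin
      + t - + 1                    ≡⟨ rearrange (+ N) (+ t) ⟩
      (+ N ℤ.+ + t) - + 1 - + N    ≡⟨ cong (λ z → z - + 1 - + N) (trans (sym (ℤ.pos-+ N t)) (trans (cong +_ N+t≡1+Qt) (ℤ.pos-+ 1 (Q ℕ.* t)))) ⟩
      (+ 1 ℤ.+ + (Q ℕ.* t)) - + 1 - + N ≡⟨ cong (λ z → (+ 1 ℤ.+ z) - + 1 - + N) (ℤ.pos-* Q t) ⟩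
      (+ 1 ℤ.+ + Q * + t) - + 1 - + N   ≡⟨ cancel-1 (+ Q * + t) (+ N) ⟩
      + Q * + t - + N              ∎
      where
      rearrange : ∀ n t → t - + 1 ≡ (n ℤ.+ t) - + 1 - n
      rearrange = ℤ-solve-∀
      cancel-1 : ∀ x n → (+ 1 ℤ.+ x) - + 1 - n ≡ x - n
      cancel-1 = ℤ-solve-∀

module IncidenceVectors (F : Field) (p h : ℕ) (p-prime : Prime p) (h≥1 : 1 ≤ h) (ord : HasOrder F ((p ^ h) ^ 2)) where

  open import Data.Integer using (ℤ; +_; _*_; _-_)
  open Congruence
  open ≡-Reasoning
  open FieldProperties F using (0#)
  open Geometry F (p ^ h)
  open Vectors F (p ^ h)
  open Hermitian F p h p-prime h≥1 ord
  open Counting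

  incidence-resp-~ : ∀ {m} {T : Vect m → Set} {f} → IsLinearSubset T → (∀ v → Dec (T v)) →
                     IsIncidenceVector (λ v → T v × OnH v) f → ∀ {v w} → NonZero v → v ~ w → f v ≡ f w
  incidence-resp-~ {T = T} T-lin T? f-incidence {v} {w} v≢0 v~w with T? v Dec.×-dec (herm v v ≟ 0#)
  ... | yes TvHv = trans (proj₁ (f-incidence v v≢0) TvHv) (sym (proj₁ (f-incidence w w≢0) (v⇒w TvHv)))
    where
    w≢0 = ~-nonZero v≢0 (~-sym v~w)
    v⇒w : T v × OnH v → T w × OnH w
    v⇒w (Tv , Hv) = IsLinearSubset.~-closed T-lin Tv (~-sym v~w) , OnH-~ Hv (~-sym v~w)
  ... | no ¬TvHv = trans (proj₂ (f-incidence v v≢0) ¬TvHv) (sym (proj₂ (f-incidence w w≢0) (¬TvHv ∘ w⇒v)))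
    where
    w≢0 = ~-nonZero v≢0 (~-sym v~w)
    w⇒v : T w × OnH w → T v × OnH v
    w⇒v (Tw , Hw) = IsLinearSubset.~-closed T-lin Tw v~w , OnH-~ Hw v~w

  incidence-on-generator : ∀ {n} (μ : Generator n) {T : Vect (suc (suc (n ℕ.+ n))) → Set} (T? : ∀ v → Dec (T v)) {f} →
                           IsIncidenceVector (λ v → T v × OnH v) f →
                           ∀ {v} → NonZero v → Generator.space μ ∋ₚ v → f v ≡ + 𝟙 (T? v)
  incidence-on-generator μ T? f-incidence {v} v≢0 μ∋v with T? v
  ... | yes Tv = proj₁ (f-incidence v v≢0) (Tv , Generator.contained μ v μ∋v)
  ... | no ¬Tv = proj₂ (f-incidence v v≢0) (¬Tv ∘ proj₁)

  sum-over-generator : ∀ {n} (μ : Generator n) {T T′ : Vect (suc (suc (n ℕ.+ n))) → Set}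
    (T? : ∀ v → Dec (T v)) (T′? : ∀ v → Dec (T′ v)) {f g} →
    IsIncidenceVector (λ v → T v × OnH v) f → IsIncidenceVector (λ v → T′ v × OnH v) g → ∀ α {L} →
    EnumeratesPoints (Generator.space μ ∋ₚ_) L →
    List.foldr ℤ._+_ (+ 0) (map (λ v → α * (f v - g v)) L) ≡ α * (+ ∑[ v ∈ L ] 𝟙 (T? v) - + ∑[ v ∈ L ] 𝟙 (T′? v))
  sum-over-generator μ T? T′? {f} {g} f-incidence g-incidence α {L} (L≢0 , L⊆μ , _) =
    ∑ℤ-scaled-difference α f g (λ v → 𝟙 (T? v)) (λ v → 𝟙 (T′? v)) L
      (λ v∈L → incidence-on-generator μ T? f-incidence (All.lookup L≢0 v∈L) (All.lookup L⊆μ v∈L))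
      (λ v∈L → incidence-on-generator μ T′? g-incidence (All.lookup L≢0 v∈L) (All.lookup L⊆μ v∈L))

  counts-congruent : ∀ {m} {S T T′ : Vect m → Set} {L} → IsLinearSubset S → (S? : ∀ v → Dec (S v)) →
    IsLinearSubset T → (T? : ∀ v → Dec (T v)) → IsLinearSubset T′ → (T′? : ∀ v → Dec (T′ v)) →
    EnumeratesPoints S L → (Any T L → Any T′ L) → (Any T′ L → Any T L) →
    + p Signed.∣ + ∑[ v ∈ L ] 𝟙 (T? v) - + ∑[ v ∈ L ] 𝟙 (T′? v)
  counts-congruent {L = L} S-lin S? T-lin T? T′-lin T′? L-enumerates T⇒T′ T′⇒T with Any.any? T? L
  ... | yes ∃T = subst (+ p Signed.∣_) (difference-of-shifts (+ t) (+ t′) (+ 1)) (Signed.∣m∣n⇒∣m-n (≡1 T-lin T? ∃T) (≡1 T′-lin T′? (T⇒T′ ∃T)))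
    where
    t = ∑[ v ∈ L ] 𝟙 (T? v)
    t′ = ∑[ v ∈ L ] 𝟙 (T′? v)
    ≡1 : ∀ {U} → IsLinearSubset U → (U? : ∀ v → Dec (U v)) → Any U L → + p Signed.∣ + ∑[ v ∈ L ] 𝟙 (U? v) - + 1
    ≡1 U-lin U? ∃U = let (N , p∣N , N+u≡1+Qu) = points-count-∩ S-lin S? U-lin U? L-enumerates ∃U in
                     ≡1-mod N+u≡1+Qu p∣N p∣q²
  ... | no ∄T = subst (λ s → + p Signed.∣ + s - + ∑[ v ∈ L ] 𝟙 (T′? v)) (sym (none T? ∄T))
                  (subst (λ s → + p Signed.∣ + 0 - + s) (sym (none T′? (∄T ∘ T′⇒T))) (Signed.divides (+ 0) refl))
    where
    none : ∀ {U} (U? : ∀ v → Dec (U v)) → ¬ Any U L → ∑[ v ∈ L ] 𝟙 (U? v) ≡ 0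
    none U? ∄U = ∑-zero L (λ v∈L → 𝟙-no (U? _) (λ Uv → ∄U (Any.map (λ { refl → Uv }) v∈L)))

open import Data.Nat using (ℕ; suc; _+_; _^_; _≤_)
open import Data.Nat.Primality using (Prime)
open import Data.Integer using (ℤ; +_; _*_; _-_)
open import Data.Product using (_×_)

theorem2p4 : (p h : ℕ) → Prime p → 1 ≤ h → (F : Field) → HasOrder F ((p ^ h) ^ 2)
    → (n : ℕ) → let open Geometry F (p ^ h) in
    (π : Subspace n (suc (suc (n + n))))
    → (vπ vπσ : Vect (suc (suc (n + n))) → ℤ)
    → IsIncidenceVector (λ v → (π ∋ₚ v) × OnH v) vπ
    → IsIncidenceVector (λ v → polar π v × OnH v) vπσ
    → (α : ℤ) → InDualCode p n (λ v → α * (vπ v - vπσ v))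
theorem2p4 p h p-prime h≥1 F ord n π vπ vπσ vπ-incidence vπσ-incidence α = constant-on-points , sums-vanish
  where
  open Geometry F (p ^ h)
  open Vectors F (p ^ h)
  open Hermitian F p h p-prime h≥1 ord
  open IncidenceVectors F p h p-prime h≥1 ord
  P = Subspace.basis π

  constant-on-points : ∀ v w → NonZero v → OnH v → v ~ w → + p Unsigned.∣ α * (vπ v - vπσ v) - α * (vπ w - vπσ w)
  constant-on-points v w v≢0 _ v~w = Signed.∣⇒∣ᵤ (subst (+ p Signed.∣_) (sym difference≡0) (Signed.divides (+ 0) refl))
    where
    difference≡0 : α * (vπ v - vπσ v) - α * (vπ w - vπσ w) ≡ + 0
    difference≡0 = trans (cong₂ (λ a b → α * (a - b) - α * (vπ w - vπσ w))
                                (incidence-resp-~ (span-linear P) (span? P) vπ-incidence v≢0 v~w)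
                                (incidence-resp-~ (polar-linear π) (polar? π) vπσ-incidence v≢0 v~w))
                         (ℤ.+-inverseʳ (α * (vπ w - vπσ w)))

  sums-vanish : ∀ μ L → EnumeratesPoints (Generator.space μ ∋ₚ_) L →
                + p Unsigned.∣ List.foldr ℤ._+_ (+ 0) (map (λ v → α * (vπ v - vπσ v)) L)
  sums-vanish μ L L-enumerates = Signed.∣⇒∣ᵤ (subst (+ p Signed.∣_)
    (sym (sum-over-generator μ (span? P) (polar? π) vπ-incidence vπσ-incidence α L-enumerates))
    (Signed.∣n⇒∣m*n α (counts-congruent (span-linear M) (span? M) (span-linear P) (span? P) (polar-linear π) (polar? π)
                                         L-enumerates (Any-span⇒Any-polar μ π L-enumerates) (Any-polar⇒Any-span μ π L-enumerates))))
    where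
    M = Subspace.basis (Generator.space μ)
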